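{- Let $p$ be an odd positive integer and let $c>0$, $d$ be integers with $(c,d)=1$. Let $q$ be a positive integer. If $d+c$ is odd, then $S_p(qd,qc:\chi)=S_p(d,c:\chi)$ if $q$ is odd and $S_p(qd,qc:\chi)=0$ if $q$ is even. If $c$ is odd, then $s_{3,p}(qd,qc:\chi)=s_{3,p}(d,c:\chi)$ if $q$ is odd and $=0$ if $q$ is even. If $d$ is odd, then $s_{4,p}(qd,qc:\chi)=s_{4,p}(d,c:\chi)$ if $q$ is odd and $=0$ if $q$ is even.
   Context: $k$ is an odd positive integer and $\chi$ is a non-principal primitive Dirichlet character modulo $k$. Bernoulli functions: $\overline{B}_n(x)=B_n(\{x\})$ for $n>1$ ($B_n$ the Bernoulli polynomials, $\{x\}$ the fractional part), $\overline{B}_1(x)=0$ for integer $x$ and $B_1(\{x\})$ otherwise. $\overline{B}_{n,\chi}(x)=k^{n-1}\sum_{j=0}^{k-1}\overline{\chi}(j)\overline{B}_n\left(\frac{j+x}{k}\right)$. For integers $d$ and $c>0$: $S_p(d,c:\chi)=\sum_{n=1}^{ck}\chi(n)\overline{B}_{p,\chi}\left(\frac{d+ck}{2c}n\right)$, $s_{3,p}(d,c:\chi)=\sum_{n=1}^{ck}(-1)^n\chi(n)\overline{B}_{p,\chi}\left(\frac{dn}{c}\right)$, $s_{4,p}(d,c:\chi)=\sum_{n=1}^{ck}\chi(n)\overline{B}_{p,\chi}\left(\frac{dn}{2c}\right)$. -}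

module Defs where

open import Level using (Level; _⊔_)
open import Data.Nat as ℕ using (ℕ; zero; suc)
open import Data.Nat.Coprimality using (Coprime)
open import Data.Nat.Divisibility using (_∣_)
open import Data.Nat.Combinatorics using (_C_)
open import Data.Integer as ℤ using (ℤ; +_)
open import Data.Rational as ℚ using (ℚ; 0ℚ; 1ℚ; floor)
open import Data.Rational.Properties using (_≟_)
open import Data.List using (List; []; _∷_; _++_; [_])
open import Data.Product using (Σ; ∃; _×_)
open import Relation.Nullary using (¬_; yes; no)
open import Relation.Binary.PropositionalEquality using (_≡_)
open import Algebra.Bundles using (CommutativeRing)

-- a / b for an integer a and a natural b (conventionally 0 when b = 0;
-- only ever used with b > 0 below)
_÷ℕ_ : ℤ → ℕ → ℚ
a ÷ℕ zero    = 0ℚ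
a ÷ℕ (suc b) = a ℚ./ suc b

ℕ→ℚ : ℕ → ℚ
ℕ→ℚ n = (+ n) ℚ./ 1

frac : ℚ → ℚ
frac x = x ℚ.- (floor x ℚ./ 1)

powℚ : ℚ → ℕ → ℚ
powℚ x zero    = 1ℚ
powℚ x (suc n) = x ℚ.* powℚ x n

-- Bernoulli numbers  B_0 = 1,  sum_{j=0}^{m} C(m+1,j) B_j = 0  (m ≥ 1),
-- so B_1 = -1/2 and B_n(x) = sum_j C(n,j) B_j x^(n-j), B_1(x) = x - 1/2.

isum : List ℚ → ℕ → (ℕ → ℚ → ℚ) → ℚ
isum []       i f = 0ℚ
isum (b ∷ bs) i f = f i b ℚ.+ isum bs (suc i) f

bernList : ℕ → List ℚ
bernList zero    = [ 1ℚ ]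
bernList (suc n) = bs ++ [ ℚ.- (((+ 1) ℚ./ suc (suc n))
                     ℚ.* isum bs 0 (λ j b → ℕ→ℚ (suc (suc n) C j) ℚ.* b)) ]
  where bs = bernList n

nth : List ℚ → ℕ → ℚ
nth []       _       = 0ℚ
nth (b ∷ bs) zero    = b
nth (b ∷ bs) (suc i) = nth bs i

bernoulli : ℕ → ℚ
bernoulli n = nth (bernList n) n

bernPoly : ℕ → ℚ → ℚ
bernPoly n x = isum (bernList n) 0 (λ j b → ℕ→ℚ (n C j) ℚ.* b ℚ.* powℚ x (n ℕ.∸ j))

bernFun : ℕ → ℚ → ℚ
bernFun 1 x with frac x ≟ 0ℚ
... | yes _ = 0ℚ
... | no  _ = bernPoly 1 (frac x)
bernFun n x = bernPoly n (frac x)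

-- Dirichlet characters with values in a commutative ring R
-- (in the statement R is an integral domain containing ℚ)

module Char {c ℓ : Level} (R : CommutativeRing c ℓ) (ι : ℚ → CommutativeRing.Carrier R) where
  open CommutativeRing R hiding (zero; sym; refl; trans)

  ∑₀ : ℕ → (ℕ → Carrier) → Carrier
  ∑₀ zero    f = 0#
  ∑₀ (suc N) f = f zero + ∑₀ N (λ i → f (suc i))

  ∑₁ : ℕ → (ℕ → Carrier) → Carrier
  ∑₁ N f = ∑₀ N (λ i → f (suc i))

  sgn : ℕ → Carrier
  sgn zero          = 1#
  sgn (suc zero)    = - 1#
  sgn (suc (suc n)) = sgn n

  record IsDirichletCharacter (k : ℕ) (χ : ℕ → Carrier) : Set (c ⊔ ℓ) where
    field
      periodic       : ∀ n → χ (n ℕ.+ k) ≈ χ n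
      multiplicative : ∀ m n → χ (m ℕ.* n) ≈ χ m * χ n
      one            : χ 1 ≈ 1#
      zero-nonCoprime : ∀ n → ¬ Coprime n k → χ n ≈ 0#
      nonzero-coprime : ∀ n → Coprime n k → ¬ (χ n ≈ 0#)

  NonPrincipal : ℕ → (ℕ → Carrier) → Set ℓ
  NonPrincipal k χ = ∃ λ n → Coprime n k × ¬ (χ n ≈ 1#)

  -- χ (mod k) is primitive: it is not induced by a character modulo any
  -- proper divisor d of k, i.e. for every d ∣ k with d < k there is n coprime
  -- to k with n ≡ 1 (mod d) and χ n ≠ 1
  Primitive : ℕ → (ℕ → Carrier) → Set ℓ
  Primitive k χ = ∀ d → d ∣ k → d ℕ.< k →
    ∃ λ n → Coprime n k × (∃ λ m → n ≡ 1 ℕ.+ m ℕ.* d) × ¬ (χ n ≈ 1#)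

  -- χ̄ is the complex conjugate character of χ, i.e. χ̄(n) = χ(n)^{-1} for
  -- (n,k) = 1 and χ̄(n) = 0 otherwise
  IsConjugate : ℕ → (ℕ → Carrier) → (ℕ → Carrier) → Set ℓ
  IsConjugate k χ χ̄ = (∀ n → Coprime n k → χ̄ n * χ n ≈ 1#)
                    × (∀ n → ¬ Coprime n k → χ̄ n ≈ 0#)

  bernChar : (χ̄ : ℕ → Carrier) (k p : ℕ) → ℚ → Carrier
  bernChar χ̄ k p x = ι (ℕ→ℚ (k ℕ.^ (p ℕ.∸ 1)))
    * ∑₀ k (λ j → χ̄ j * ι (bernFun p ((ℕ→ℚ j ℚ.+ x) ℚ.* ((+ 1) ÷ℕ k))))

  S : (χ χ̄ : ℕ → Carrier) (k p : ℕ) (d : ℤ) (c : ℕ) → Carrier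
  S χ χ̄ k p d c = ∑₁ (c ℕ.* k) (λ n →
    χ n * bernChar χ̄ k p (((d ℤ.+ + (c ℕ.* k)) ℤ.* + n) ÷ℕ (2 ℕ.* c)))

  s₃ : (χ χ̄ : ℕ → Carrier) (k p : ℕ) (d : ℤ) (c : ℕ) → Carrier
  s₃ χ χ̄ k p d c = ∑₁ (c ℕ.* k) (λ n →
    sgn n * χ n * bernChar χ̄ k p ((d ℤ.* + n) ÷ℕ c))

  s₄ : (χ χ̄ : ℕ → Carrier) (k p : ℕ) (d : ℤ) (c : ℕ) → Carrier
  s₄ χ χ̄ k p d c = ∑₁ (c ℕ.* k) (λ n →
    χ n * bernChar χ̄ k p ((d ℤ.* + n) ÷ℕ (2 ℕ.* c)))

module Submission where

-- Since qd/(qc) = d/c, the sums for (qd, qc) have the same summands g(n) as those for (d, c), only over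
-- the q times longer range n = 1, ..., qck. Each summand is periodic with period N = 2ck and odd about N,
-- g(N − n) = −g(n): indeed χ(N − n) = χ(−1)χ(n), while \bar B_{p,χ}(x + mk) = \bar B_{p,χ}(x) and
-- \bar B_{p,χ}(mk − x) = −χ̄(−1) \bar B_{p,χ}(x) because \bar B_p is 1-periodic and, p being odd, odd;
-- for s₃ the extra factor (−1)^n is even about N. Such a g sums to 0 over each period, so the sum over
-- q half-periods equals the sum over one half-period for odd q and vanishes for even q. The oddness of
-- \bar B_p rests on B_n(1 − x) = (−1)^n B_n(x), proved with the binomial convolution of sequences
-- (the product of exponential generating functions).

open import Defs
open import Level using (Level; 0ℓ)
open import Function.Base using (_∘_)
open import Data.Nat as ℕ using (ℕ; zero; suc; _∸_; z≤n; s≤s)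
import Data.Nat.Properties as ℕP
open import Data.Nat.Induction using (<-rec)
open import Data.Nat.Divisibility as ℕD using (_∣_; divides)
open import Data.Nat.Coprimality as ℕC using (Coprime; coprime?)
open import Data.Nat.Combinatorics using (_C_; nCk+nC[k+1]≡[n+1]C[k+1]; nCn≡1; nC1≡n; nCk≡nC[n∸k]; k>n⇒nCk≡0)
open import Data.Nat.Tactic.RingSolver using () renaming (solve-∀ to ℕ-solve-∀)
open import Data.Integer as ℤ using (ℤ; +_)
import Data.Integer.Properties as ℤP
import Data.Integer.DivMod as ℤD
open import Data.Integer.Tactic.RingSolver using () renaming (solve-∀ to ℤ-solve-∀)
open import Data.Rational as ℚ using (ℚ; mkℚ; 0ℚ; 1ℚ; floor; fromℚᵘ; toℚᵘ; ↥_; ↧_)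
open import Data.Rational.Base using (+-*-rawRing)
import Data.Rational.Properties as ℚP
import Data.Rational.Unnormalised as ℚᵘ
import Data.Rational.Unnormalised.Properties as ℚᵘP
open import Data.List using (_∷_; []; _++_; [_]; length)
import Data.List.Properties as ListP
open import Data.Product using (_×_; _,_; proj₁; proj₂; ∃)
open import Data.Empty using (⊥-elim)
open import Relation.Nullary using (¬_; yes; no)
open import Relation.Nullary.Decidable using (dec⇒maybe)
open import Relation.Binary.PropositionalEquality as P using (_≡_)
import Relation.Binary.Reasoning.Setoid as SetoidReasoning
open import Algebra.Bundles using (Ring; CommutativeRing)
open import Algebra.Morphism.Structures using (IsRingHomomorphism)
import Algebra.Properties.Ring as RingProperties
import Algebra.Properties.CommutativeSemigroup as CommutativeSemigroupProperties
open import Tactic.RingSolver using (solve-∀)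
import Tactic.RingSolver.Core.AlmostCommutativeRing as ACR

odd⇒≡1+r*2 : ∀ q → ¬ (2 ∣ q) → ∃ λ r → q ≡ 1 ℕ.+ r ℕ.* 2
odd⇒≡1+r*2 zero      q-odd = ⊥-elim (q-odd (2 ℕD.∣0))
odd⇒≡1+r*2 (suc zero) _    = 0 , P.refl
odd⇒≡1+r*2 (suc (suc q)) q-odd with odd⇒≡1+r*2 q (q-odd ∘ ℕD.∣m∣n⇒∣m+n (ℕD.∣-refl {2}))
... | r , q≡ = suc r , P.cong (suc ∘ suc) q≡

module FiniteSum {a ℓ : Level} (R : Ring a ℓ) where
  open Ring R hiding (zero)
  open RingProperties R using (-0#≈0#; -‿+-comm; +-cancelˡ; -‿distribʳ-*)
  open CommutativeSemigroupProperties +-commutativeSemigroup using () renaming (interchange to +-interchange)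
  open SetoidReasoning setoid

  Σ : ℕ → (ℕ → Carrier) → Carrier
  Σ zero    f = 0#
  Σ (suc N) f = f 0 + Σ N (f ∘ suc)

  Σ₁ : ℕ → (ℕ → Carrier) → Carrier
  Σ₁ N f = Σ N (f ∘ suc)

  Σ-cong-< : ∀ N {f g} → (∀ i → i ℕ.< N → f i ≈ g i) → Σ N f ≈ Σ N g
  Σ-cong-< zero    f≈g = refl
  Σ-cong-< (suc N) f≈g = +-cong (f≈g 0 (s≤s z≤n)) (Σ-cong-< N (λ i i<N → f≈g (suc i) (s≤s i<N)))

  Σ-cong : ∀ N {f g} → (∀ i → f i ≈ g i) → Σ N f ≈ Σ N g
  Σ-cong N f≈g = Σ-cong-< N (λ i _ → f≈g i)

  Σ-≈0 : ∀ N {f} → (∀ i → i ℕ.< N → f i ≈ 0#) → Σ N f ≈ 0#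
  Σ-≈0 zero    f≈0 = refl
  Σ-≈0 (suc N) f≈0 = trans (+-cong (f≈0 0 (s≤s z≤n)) (Σ-≈0 N (λ i i<N → f≈0 (suc i) (s≤s i<N))))
                           (+-identityˡ 0#)

  Σ-+ : ∀ N f g → Σ N (λ i → f i + g i) ≈ Σ N f + Σ N g
  Σ-+ zero    f g = sym (+-identityˡ 0#)
  Σ-+ (suc N) f g = trans (+-congˡ (Σ-+ N (f ∘ suc) (g ∘ suc))) (+-interchange (f 0) (g 0) _ _)

  Σ-*ˡ : ∀ N x f → Σ N (λ i → x * f i) ≈ x * Σ N f
  Σ-*ˡ zero    x f = sym (zeroʳ x)
  Σ-*ˡ (suc N) x f = trans (+-congˡ (Σ-*ˡ N x (f ∘ suc))) (sym (distribˡ x _ _))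

  Σ-neg : ∀ N f → Σ N (λ i → - f i) ≈ - Σ N f
  Σ-neg zero    f = sym -0#≈0#
  Σ-neg (suc N) f = trans (+-congˡ (Σ-neg N (f ∘ suc))) (-‿+-comm _ _)

  Σ-snoc : ∀ N f → Σ (suc N) f ≈ Σ N f + f N
  Σ-snoc zero    f = trans (+-identityʳ _) (sym (+-identityˡ _))
  Σ-snoc (suc N) f = trans (+-congˡ (Σ-snoc N (f ∘ suc))) (sym (+-assoc _ _ _))

  Σ-++ : ∀ A B f → Σ (A ℕ.+ B) f ≈ Σ A f + Σ B (λ i → f (A ℕ.+ i))
  Σ-++ zero    B f = sym (+-identityˡ _)
  Σ-++ (suc A) B f = trans (+-congˡ (Σ-++ A B (f ∘ suc))) (sym (+-assoc _ _ _))

  Σ-reverse : ∀ N f → Σ N f ≈ Σ N (λ i → f (N ∸ suc i))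
  Σ-reverse zero    f = refl
  Σ-reverse (suc N) f = begin
    f 0 + Σ N (f ∘ suc)                         ≈⟨ +-congˡ (Σ-reverse N (f ∘ suc)) ⟩
    f 0 + Σ N (λ i → f (suc (N ∸ suc i)))       ≈⟨ +-comm _ _ ⟩
    Σ N (λ i → f (suc (N ∸ suc i))) + f 0       ≈⟨ +-cong (Σ-cong-< N λ i i<N → reflexive (P.cong f (P.sym (ℕP.+-∸-assoc 1 i<N))))
                                                          (reflexive (P.cong f (P.sym (ℕP.n∸n≡0 N)))) ⟩
    Σ N (λ i → f (suc N ∸ suc i)) + f (N ∸ N)   ≈⟨ Σ-snoc N (λ i → f (suc N ∸ suc i)) ⟨
    Σ (suc N) (λ i → f (suc N ∸ suc i))         ∎

  Periodic : ℕ → (ℕ → Carrier) → Set ℓ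
  Periodic N g = ∀ n → g (n ℕ.+ N) ≈ g n

  ReflectionEven : ℕ → (ℕ → Carrier) → Set ℓ
  ReflectionEven N g = ∀ n → n ℕ.≤ N → g (N ∸ n) ≈ g n

  ReflectionOdd : ℕ → (ℕ → Carrier) → Set ℓ
  ReflectionOdd N g = ∀ n → n ℕ.≤ N → g (N ∸ n) ≈ - g n

  Σ₁-reverse : ∀ N f → Σ₁ N f ≈ Σ N (λ i → f (N ∸ i))
  Σ₁-reverse N f = trans (Σ-reverse N (f ∘ suc))
                         (Σ-cong-< N (λ i i<N → reflexive (P.cong f (P.sym (ℕP.+-∸-assoc 1 i<N)))))

  Σ₁≈-Σ : ∀ N {g} → ReflectionOdd N g → Σ₁ N g ≈ - Σ N g
  Σ₁≈-Σ N {g} g-odd = begin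
    Σ₁ N g                  ≈⟨ Σ₁-reverse N g ⟩
    Σ N (λ i → g (N ∸ i))   ≈⟨ Σ-cong-< N (λ i i<N → g-odd i (ℕP.<⇒≤ i<N)) ⟩
    Σ N (λ i → - g i)       ≈⟨ Σ-neg N g ⟩
    - Σ N g                 ∎

  *-periodic : ∀ N {w g} → Periodic N w → Periodic N g → Periodic N (λ n → w n * g n)
  *-periodic N w-per g-per n = *-cong (w-per n) (g-per n)

  *-reflectionOdd : ∀ N {w g} → ReflectionEven N w → ReflectionOdd N g → ReflectionOdd N (λ n → w n * g n)
  *-reflectionOdd N {w} {g} w-even g-odd n n≤N =
    trans (*-cong (w-even n n≤N) (g-odd n n≤N)) (sym (-‿distribʳ-* (w n) (g n)))

  Σ₁≈Σ : ∀ N {g} → Periodic N g → Σ₁ N g ≈ Σ N g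
  Σ₁≈Σ N {g} g-per = +-cancelˡ (g 0) _ _ (begin
    g 0 + Σ₁ N g    ≈⟨ Σ-snoc N g ⟩
    Σ N g + g N     ≈⟨ +-congˡ (g-per 0) ⟩
    Σ N g + g 0     ≈⟨ +-comm _ _ ⟩
    g 0 + Σ N g     ∎)

  periodic-multiple : ∀ N {g} → Periodic N g → ∀ r n → g (r ℕ.* N ℕ.+ n) ≈ g n
  periodic-multiple N g-per zero    n = refl
  periodic-multiple N {g} g-per (suc r) n =
    trans (reflexive (P.cong g (P.trans (ℕP.+-assoc N (r ℕ.* N) n) (ℕP.+-comm N _))))
          (trans (g-per _) (periodic-multiple N g-per r n))

  Σ₁-skip-periods : ∀ N {g} → Periodic N g → ∀ r M → Σ₁ (r ℕ.* N ℕ.+ M) g ≈ Σ₁ (r ℕ.* N) g + Σ₁ M g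
  Σ₁-skip-periods N {g} g-per r M = trans (Σ-++ (r ℕ.* N) M (g ∘ suc)) (+-congˡ (Σ-cong M shift))
    where
    shift : ∀ i → g (suc (r ℕ.* N ℕ.+ i)) ≈ g (suc i)
    shift i = trans (reflexive (P.cong g (P.sym (ℕP.+-suc (r ℕ.* N) i)))) (periodic-multiple N g-per r (suc i))

  module _ (halve : ∀ t → t + t ≈ 0# → t ≈ 0#) where

    Σ₁-period≈0 : ∀ N {g} → Periodic N g → ReflectionOdd N g → Σ₁ N g ≈ 0#
    Σ₁-period≈0 N {g} g-per g-odd = halve (Σ₁ N g) (begin
      Σ₁ N g + Σ₁ N g    ≈⟨ +-cong (Σ₁≈Σ N g-per) (Σ₁≈-Σ N g-odd) ⟩
      Σ N g + - Σ N g    ≈⟨ -‿inverseʳ _ ⟩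
      0#                 ∎)

    Σ₁-periods≈0 : ∀ N {g} → Periodic N g → ReflectionOdd N g → ∀ r → Σ₁ (r ℕ.* N) g ≈ 0#
    Σ₁-periods≈0 N g-per g-odd zero    = refl
    Σ₁-periods≈0 N {g} g-per g-odd (suc r) = begin
      Σ₁ (N ℕ.+ r ℕ.* N) g     ≈⟨ reflexive (P.cong (λ L → Σ₁ L g) (ℕP.+-comm N (r ℕ.* N))) ⟩
      Σ₁ (r ℕ.* N ℕ.+ N) g     ≈⟨ Σ₁-skip-periods N g-per r N ⟩
      Σ₁ (r ℕ.* N) g + Σ₁ N g  ≈⟨ +-cong (Σ₁-periods≈0 N g-per g-odd r) (Σ₁-period≈0 N g-per g-odd) ⟩
      0# + 0#                  ≈⟨ +-identityˡ 0# ⟩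
      0#                       ∎

    Σ₁-half-periods : ∀ M {g} → Periodic (M ℕ.+ M) g → ReflectionOdd (M ℕ.+ M) g → ∀ q →
      (¬ (2 ∣ q) → Σ₁ (q ℕ.* M) g ≈ Σ₁ M g) × (2 ∣ q → Σ₁ (q ℕ.* M) g ≈ 0#)
    Σ₁-half-periods M {g} g-per g-odd q = odd , even
      where
      r*2*M≡r*[M+M] : ∀ r → r ℕ.* 2 ℕ.* M ≡ r ℕ.* (M ℕ.+ M)
      r*2*M≡r*[M+M] r = P.trans (ℕP.*-assoc r 2 M) (P.cong (r ℕ.*_) (P.cong (M ℕ.+_) (ℕP.+-identityʳ M)))
      odd : ¬ (2 ∣ q) → Σ₁ (q ℕ.* M) g ≈ Σ₁ M g
      odd q-odd with odd⇒≡1+r*2 q q-odd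
      ... | r , P.refl = begin
        Σ₁ (M ℕ.+ r ℕ.* 2 ℕ.* M) g          ≈⟨ reflexive (P.cong (λ L → Σ₁ L g)
                                                  (P.trans (ℕP.+-comm M _) (P.cong (ℕ._+ M) (r*2*M≡r*[M+M] r)))) ⟩
        Σ₁ (r ℕ.* (M ℕ.+ M) ℕ.+ M) g        ≈⟨ Σ₁-skip-periods (M ℕ.+ M) g-per r M ⟩
        Σ₁ (r ℕ.* (M ℕ.+ M)) g + Σ₁ M g     ≈⟨ +-congʳ (Σ₁-periods≈0 (M ℕ.+ M) g-per g-odd r) ⟩
        0# + Σ₁ M g                         ≈⟨ +-identityˡ _ ⟩
        Σ₁ M g                              ∎
      even : 2 ∣ q → Σ₁ (q ℕ.* M) g ≈ 0#
      even (divides r P.refl) = trans (reflexive (P.cong (λ L → Σ₁ L g) (r*2*M≡r*[M+M] r)))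
                                      (Σ₁-periods≈0 (M ℕ.+ M) g-per g-odd r)

fromℚᵘ-homo-+ : ∀ p q → fromℚᵘ (p ℚᵘ.+ q) ≡ fromℚᵘ p ℚ.+ fromℚᵘ q
fromℚᵘ-homo-+ p q = ℚP.toℚᵘ-injective (ℚᵘP.≃-trans (ℚP.toℚᵘ-fromℚᵘ _)
  (ℚᵘP.≃-sym (ℚᵘP.≃-trans (ℚP.toℚᵘ-homo-+ (fromℚᵘ p) (fromℚᵘ q))
                          (ℚᵘP.+-cong (ℚP.toℚᵘ-fromℚᵘ p) (ℚP.toℚᵘ-fromℚᵘ q)))))

fromℚᵘ-homo-* : ∀ p q → fromℚᵘ (p ℚᵘ.* q) ≡ fromℚᵘ p ℚ.* fromℚᵘ q
fromℚᵘ-homo-* p q = ℚP.toℚᵘ-injective (ℚᵘP.≃-trans (ℚP.toℚᵘ-fromℚᵘ _)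
  (ℚᵘP.≃-sym (ℚᵘP.≃-trans (ℚP.toℚᵘ-homo-* (fromℚᵘ p) (fromℚᵘ q))
                          (ℚᵘP.*-cong (ℚP.toℚᵘ-fromℚᵘ p) (ℚP.toℚᵘ-fromℚᵘ q)))))

fromℚᵘ-homo‿- : ∀ p → fromℚᵘ (ℚᵘ.- p) ≡ ℚ.- fromℚᵘ p
fromℚᵘ-homo‿- p = ℚP.toℚᵘ-injective (ℚᵘP.≃-trans (ℚP.toℚᵘ-fromℚᵘ _)
  (ℚᵘP.≃-sym (ℚᵘP.≃-trans (ℚP.toℚᵘ-homo‿- (fromℚᵘ p)) (ℚᵘP.-‿cong (ℚP.toℚᵘ-fromℚᵘ p)))))

fromℚᵘ-≃ : ∀ p q → p ℚᵘ.≃ q → fromℚᵘ p ≡ fromℚᵘ q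
fromℚᵘ-≃ _ _ = ℚP.fromℚᵘ-cong

ℤ→ℚ : ℤ → ℚ
ℤ→ℚ z = z ℚ./ 1

ℤ→ℚ-homo-+ : ∀ a b → ℤ→ℚ (a ℤ.+ b) ≡ ℤ→ℚ a ℚ.+ ℤ→ℚ b
ℤ→ℚ-homo-+ a b = P.trans (fromℚᵘ-≃ (ℚᵘ.mkℚᵘ (a ℤ.+ b) 0) (ℚᵘ.mkℚᵘ a 0 ℚᵘ.+ ℚᵘ.mkℚᵘ b 0) (ℚᵘ.*≡* (eq a b)))
                         (fromℚᵘ-homo-+ (ℚᵘ.mkℚᵘ a 0) (ℚᵘ.mkℚᵘ b 0))
  where
  eq : ∀ a b → (a ℤ.+ b) ℤ.* + 1 ≡ (a ℤ.* + 1 ℤ.+ b ℤ.* + 1) ℤ.* + 1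
  eq = ℤ-solve-∀

ℤ→ℚ-homo-* : ∀ a b → ℤ→ℚ (a ℤ.* b) ≡ ℤ→ℚ a ℚ.* ℤ→ℚ b
ℤ→ℚ-homo-* a b = fromℚᵘ-homo-* (ℚᵘ.mkℚᵘ a 0) (ℚᵘ.mkℚᵘ b 0)

ℤ→ℚ-homo‿- : ∀ a → ℤ→ℚ (ℤ.- a) ≡ ℚ.- ℤ→ℚ a
ℤ→ℚ-homo‿- a = fromℚᵘ-homo‿- (ℚᵘ.mkℚᵘ a 0)

ℕ→ℚ-homo-+ : ∀ m n → ℕ→ℚ (m ℕ.+ n) ≡ ℕ→ℚ m ℚ.+ ℕ→ℚ n
ℕ→ℚ-homo-+ m n = P.trans (P.cong ℤ→ℚ (P.sym (ℤP.pos-+ m n))) (ℤ→ℚ-homo-+ (+ m) (+ n))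

÷ℕ-cross : ∀ a b D D′ → a ℤ.* + suc D′ ≡ b ℤ.* + suc D → a ÷ℕ suc D ≡ b ÷ℕ suc D′
÷ℕ-cross a b D D′ eq = fromℚᵘ-≃ (ℚᵘ.mkℚᵘ a D) (ℚᵘ.mkℚᵘ b D′) (ℚᵘ.*≡* eq)

÷ℕ-+-ℤ→ℚ : ∀ a z D → a ÷ℕ suc D ℚ.+ ℤ→ℚ z ≡ (a ℤ.+ z ℤ.* + suc D) ÷ℕ suc D
÷ℕ-+-ℤ→ℚ a z D = P.trans (P.sym (fromℚᵘ-homo-+ (ℚᵘ.mkℚᵘ a D) (ℚᵘ.mkℚᵘ z 0)))
                         (fromℚᵘ-≃ (ℚᵘ.mkℚᵘ a D ℚᵘ.+ ℚᵘ.mkℚᵘ z 0) (ℚᵘ.mkℚᵘ (a ℤ.+ z ℤ.* + suc D) D)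
                                   (ℚᵘ.*≡* (eq a z (+ suc D))))
  where
  eq : ∀ a z d → (a ℤ.* + 1 ℤ.+ z ℤ.* d) ℤ.* d ≡ (a ℤ.+ z ℤ.* d) ℤ.* (d ℤ.* + 1)
  eq = ℤ-solve-∀

-‿÷ℕ : ∀ a D → ℚ.- (a ÷ℕ suc D) ≡ (ℤ.- a) ÷ℕ suc D
-‿÷ℕ a D = P.sym (fromℚᵘ-homo‿- (ℚᵘ.mkℚᵘ a D))

ℕ→ℚ*1÷ℕ : ∀ D → ℕ→ℚ (suc D) ℚ.* ((+ 1) ÷ℕ suc D) ≡ 1ℚ
ℕ→ℚ*1÷ℕ D = P.trans (P.sym (fromℚᵘ-homo-* (ℚᵘ.mkℚᵘ (+ suc D) 0) (ℚᵘ.mkℚᵘ (+ 1) D)))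
                    (fromℚᵘ-≃ (ℚᵘ.mkℚᵘ (+ suc D) 0 ℚᵘ.* ℚᵘ.mkℚᵘ (+ 1) D) (ℚᵘ.mkℚᵘ (+ 1) 0)
                              (ℚᵘ.*≡* (eq (+ suc D))))
  where
  eq : ∀ d → (d ℤ.* + 1) ℤ.* + 1 ≡ + 1 ℤ.* (+ 1 ℤ.* d)
  eq = ℤ-solve-∀

linear-÷ℕ-periodic : ∀ A D N M → A ℤ.* + N ≡ M ℤ.* + suc D →
                     ∀ n → (A ℤ.* + (n ℕ.+ N)) ÷ℕ suc D ≡ (A ℤ.* + n) ÷ℕ suc D ℚ.+ ℤ→ℚ M
linear-÷ℕ-periodic A D N M AN≡MD n = P.trans (P.cong (_÷ℕ suc D) An+AN≡An+MD) (P.sym (÷ℕ-+-ℤ→ℚ (A ℤ.* + n) M D))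
  where
  An+AN≡An+MD : A ℤ.* + (n ℕ.+ N) ≡ A ℤ.* + n ℤ.+ M ℤ.* + suc D
  An+AN≡An+MD = P.trans (P.cong (A ℤ.*_) (ℤP.pos-+ n N))
                        (P.trans (ℤP.*-distribˡ-+ A (+ n) (+ N)) (P.cong (λ t → A ℤ.* + n ℤ.+ t) AN≡MD))

linear-÷ℕ-reflect : ∀ A D N M → A ℤ.* + N ≡ M ℤ.* + suc D →
                    ∀ n → n ℕ.≤ N → (A ℤ.* + (N ℕ.∸ n)) ÷ℕ suc D ≡ ℤ→ℚ M ℚ.- (A ℤ.* + n) ÷ℕ suc D
linear-÷ℕ-reflect A D N M AN≡MD n n≤N = begin
  (A ℤ.* + (N ℕ.∸ n)) ÷ℕ suc D                  ≡⟨ P.cong (_÷ℕ suc D) A[N-n]≡-An+MD ⟩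
  (ℤ.- (A ℤ.* + n) ℤ.+ M ℤ.* + suc D) ÷ℕ suc D  ≡⟨ ÷ℕ-+-ℤ→ℚ (ℤ.- (A ℤ.* + n)) M D ⟨
  (ℤ.- (A ℤ.* + n)) ÷ℕ suc D ℚ.+ ℤ→ℚ M          ≡⟨ P.cong (ℚ._+ ℤ→ℚ M) (-‿÷ℕ (A ℤ.* + n) D) ⟨
  ℚ.- ((A ℤ.* + n) ÷ℕ suc D) ℚ.+ ℤ→ℚ M          ≡⟨ ℚP.+-comm _ (ℤ→ℚ M) ⟩
  ℤ→ℚ M ℚ.- (A ℤ.* + n) ÷ℕ suc D                ∎
  where
  open P.≡-Reasoning
  At≡-An+A[t+n] : ∀ A t n → A ℤ.* t ≡ ℤ.- (A ℤ.* n) ℤ.+ A ℤ.* (t ℤ.+ n)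
  At≡-An+A[t+n] = ℤ-solve-∀
  A[N-n]≡-An+MD : A ℤ.* + (N ℕ.∸ n) ≡ ℤ.- (A ℤ.* + n) ℤ.+ M ℤ.* + suc D
  A[N-n]≡-An+MD = P.trans (At≡-An+A[t+n] A (+ (N ℕ.∸ n)) (+ n))
    (P.cong (λ t → ℤ.- (A ℤ.* + n) ℤ.+ t)
            (P.trans (P.cong (A ℤ.*_) (P.trans (P.sym (ℤP.pos-+ (N ℕ.∸ n) n)) (P.cong +_ (ℕP.m∸n+n≡m n≤N)))) AN≡MD))

module BernoulliPolynomials where
  open import Data.Rational.Base using (_+_; _*_; -_; _-_)
  open ℚP using (+-*-commutativeRing; _≟_)
  open P using (refl; cong; cong₂; sym; trans)
  open P.≡-Reasoning
  open RingProperties (CommutativeRing.ring +-*-commutativeRing) using (+-identityˡ-unique)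
  open FiniteSum (CommutativeRing.ring +-*-commutativeRing) using (Σ; Σ-cong; Σ-cong-<; Σ-≈0; Σ-+; Σ-snoc)

  ℚ-ring : ACR.AlmostCommutativeRing 0ℓ 0ℓ
  ℚ-ring = ACR.fromCommutativeRing +-*-commutativeRing (λ x → dec⇒maybe (0ℚ ≟ x))

  Seq : Set
  Seq = ℕ → ℚ

  ∂ : Seq → Seq
  ∂ a n = a (suc n)

  -- Coefficients of the product of exponential generating functions, via the Leibniz rule for ∂.
  conv : ℕ → Seq → Seq → ℚ
  conv zero    a b = a 0 * b 0
  conv (suc n) a b = conv n (∂ a) b + conv n a (∂ b)

  conv-cong : ∀ n {a a′ b b′} → (∀ m → a m ≡ a′ m) → (∀ m → b m ≡ b′ m) → conv n a b ≡ conv n a′ b′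
  conv-cong zero    a≗a′ b≗b′ = cong₂ _*_ (a≗a′ 0) (b≗b′ 0)
  conv-cong (suc n) a≗a′ b≗b′ = cong₂ _+_ (conv-cong n (a≗a′ ∘ suc) b≗b′) (conv-cong n a≗a′ (b≗b′ ∘ suc))

  conv-comm : ∀ n a b → conv n a b ≡ conv n b a
  conv-comm zero    a b = ℚP.*-comm (a 0) (b 0)
  conv-comm (suc n) a b = trans (cong₂ _+_ (conv-comm n (∂ a) b) (conv-comm n a (∂ b))) (ℚP.+-comm (conv n b (∂ a)) (conv n (∂ b) a))

  conv-+ˡ : ∀ n a a′ b → conv n (λ m → a m + a′ m) b ≡ conv n a b + conv n a′ b
  conv-+ˡ zero    a a′ b = ℚP.*-distribʳ-+ (b 0) (a 0) (a′ 0)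
  conv-+ˡ (suc n) a a′ b = trans (cong₂ _+_ (conv-+ˡ n (∂ a) (∂ a′) b) (conv-+ˡ n a a′ (∂ b)))
                                (interchange (conv n (∂ a) b) (conv n (∂ a′) b) (conv n a (∂ b)) (conv n a′ (∂ b)))
    where
    interchange : ∀ x y z w → (x + y) + (z + w) ≡ (x + z) + (y + w)
    interchange = solve-∀ ℚ-ring

  conv-+ʳ : ∀ n a b b′ → conv n a (λ m → b m + b′ m) ≡ conv n a b + conv n a b′
  conv-+ʳ n a b b′ = trans (conv-comm n a _)
    (trans (conv-+ˡ n b b′ a) (cong₂ _+_ (conv-comm n b a) (conv-comm n b′ a)))

  conv-*ˡ : ∀ n s a b → conv n (λ m → s * a m) b ≡ s * conv n a b
  conv-*ˡ zero    s a b = ℚP.*-assoc s (a 0) (b 0)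
  conv-*ˡ (suc n) s a b = trans (cong₂ _+_ (conv-*ˡ n s (∂ a) b) (conv-*ˡ n s a (∂ b))) (sym (ℚP.*-distribˡ-+ s _ _))

  conv-*ʳ : ∀ n s a b → conv n a (λ m → s * b m) ≡ s * conv n a b
  conv-*ʳ n s a b = trans (conv-comm n a _) (trans (conv-*ˡ n s b a) (cong (s *_) (conv-comm n b a)))

  conv-assoc : ∀ n a b c → conv n (λ m → conv m a b) c ≡ conv n a (λ m → conv m b c)
  conv-assoc zero    a b c = ℚP.*-assoc (a 0) (b 0) (c 0)
  conv-assoc (suc n) a b c = begin
    conv n (λ m → conv m (∂ a) b + conv m a (∂ b)) c + conv n (λ m → conv m a b) (∂ c)
      ≡⟨ cong (_+ conv n (λ m → conv m a b) (∂ c)) (conv-+ˡ n _ _ c) ⟩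
    (conv n (λ m → conv m (∂ a) b) c + conv n (λ m → conv m a (∂ b)) c) + conv n (λ m → conv m a b) (∂ c)
      ≡⟨ cong₂ _+_ (cong₂ _+_ (conv-assoc n (∂ a) b c) (conv-assoc n a (∂ b) c)) (conv-assoc n a b (∂ c)) ⟩
    (conv n (∂ a) (λ m → conv m b c) + conv n a (λ m → conv m (∂ b) c)) + conv n a (λ m → conv m b (∂ c))
      ≡⟨ ℚP.+-assoc (conv n (∂ a) (λ m → conv m b c)) (conv n a (λ m → conv m (∂ b) c)) (conv n a (λ m → conv m b (∂ c))) ⟩
    conv n (∂ a) (λ m → conv m b c) + (conv n a (λ m → conv m (∂ b) c) + conv n a (λ m → conv m b (∂ c)))
      ≡⟨ cong (λ t → conv n (∂ a) (λ m → conv m b c) + t) (conv-+ʳ n a _ _) ⟨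
    conv n (∂ a) (λ m → conv m b c) + conv n a (λ m → conv m (∂ b) c + conv m b (∂ c)) ∎

  conv-identityˡ : ∀ n b → conv n (powℚ 0ℚ) b ≡ b n
  conv-identityˡ zero    b = ℚP.*-identityˡ (b 0)
  conv-identityˡ (suc n) b = trans (cong₂ _+_ (trans (conv-*ˡ n 0ℚ (powℚ 0ℚ) b) (ℚP.*-zeroˡ (conv n (powℚ 0ℚ) b)))
                                               (conv-identityˡ n (∂ b)))
                                   (ℚP.+-identityˡ (b (suc n)))

  conv-powers : ∀ n x y → conv n (powℚ x) (powℚ y) ≡ powℚ (x + y) n
  conv-powers zero    x y = refl
  conv-powers (suc n) x y = begin
    conv n (λ m → x * powℚ x m) (powℚ y) + conv n (powℚ x) (λ m → y * powℚ y m)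
      ≡⟨ cong₂ _+_ (conv-*ˡ n x (powℚ x) (powℚ y)) (conv-*ʳ n y (powℚ x) (powℚ y)) ⟩
    x * conv n (powℚ x) (powℚ y) + y * conv n (powℚ x) (powℚ y)
      ≡⟨ cong₂ (λ s t → x * s + y * t) (conv-powers n x y) (conv-powers n x y) ⟩
    x * powℚ (x + y) n + y * powℚ (x + y) n
      ≡⟨ ℚP.*-distribʳ-+ _ x y ⟨
    (x + y) * powℚ (x + y) n ∎

  sgnℚ : ℕ → ℚ
  sgnℚ zero    = 1ℚ
  sgnℚ (suc n) = - sgnℚ n

  alternate : Seq → Seq
  alternate a m = sgnℚ m * a m

  conv-alternate : ∀ n a b → conv n (alternate a) (alternate b) ≡ sgnℚ n * conv n a b
  conv-alternate zero    a b = 1x*1y≡1[xy] (a 0) (b 0)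
    where
    1x*1y≡1[xy] : ∀ x y → (1ℚ * x) * (1ℚ * y) ≡ 1ℚ * (x * y)
    1x*1y≡1[xy] = solve-∀ ℚ-ring
  conv-alternate (suc n) a b = begin
    conv n (∂ (alternate a)) (alternate b) + conv n (alternate a) (∂ (alternate b))
      ≡⟨ cong₂ _+_ (conv-cong n (λ m → -s*x (sgnℚ m) (a (suc m))) (λ _ → refl))
                   (conv-cong n (λ _ → refl) (λ m → -s*x (sgnℚ m) (b (suc m)))) ⟩
    conv n (λ m → - 1ℚ * alternate (∂ a) m) (alternate b) + conv n (alternate a) (λ m → - 1ℚ * alternate (∂ b) m)
      ≡⟨ cong₂ _+_ (conv-*ˡ n (- 1ℚ) _ _) (conv-*ʳ n (- 1ℚ) _ _) ⟩
    - 1ℚ * conv n (alternate (∂ a)) (alternate b) + - 1ℚ * conv n (alternate a) (alternate (∂ b))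
      ≡⟨ cong₂ (λ s t → - 1ℚ * s + - 1ℚ * t) (conv-alternate n (∂ a) b) (conv-alternate n a (∂ b)) ⟩
    - 1ℚ * (sgnℚ n * conv n (∂ a) b) + - 1ℚ * (sgnℚ n * conv n a (∂ b))
      ≡⟨ collect (sgnℚ n) _ _ ⟩
    - sgnℚ n * (conv n (∂ a) b + conv n a (∂ b)) ∎
    where
    -s*x : ∀ s x → - s * x ≡ - 1ℚ * (s * x)
    -s*x = solve-∀ ℚ-ring
    collect : ∀ s x y → - 1ℚ * (s * x) + - 1ℚ * (s * y) ≡ - s * (x + y)
    collect = solve-∀ ℚ-ring

  alternate-powers : ∀ x m → alternate (powℚ x) m ≡ powℚ (- x) m
  alternate-powers x zero    = ℚP.*-identityˡ 1ℚ
  alternate-powers x (suc m) = trans (swap (sgnℚ m) x (powℚ x m)) (cong (- x *_) (alternate-powers x m))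
    where
    swap : ∀ s x p → - s * (x * p) ≡ - x * (s * p)
    swap = solve-∀ ℚ-ring

  binomialSum : ℕ → Seq → Seq → ℚ
  binomialSum n a b = Σ (suc n) (λ j → ℕ→ℚ (n C j) * a j * b (n ∸ j))

  binomialSum-suc : ∀ n a b → binomialSum (suc n) a b ≡ binomialSum n (∂ a) b + binomialSum n a (∂ b)
  binomialSum-suc n a b = begin
    H 0 + Σ (suc n) (λ j → ℕ→ℚ (suc n C suc j) * a (suc j) * b (n ∸ j))
      ≡⟨ cong (λ t → H 0 + t) (trans (Σ-cong (suc n) pascal) (Σ-+ (suc n) (λ j → ℕ→ℚ (n C j) * a (suc j) * b (n ∸ j)) G)) ⟩
    H 0 + (binomialSum n (∂ a) b + Σ (suc n) G)
      ≡⟨ x+[y+z]≡y+[x+z] (H 0) (binomialSum n (∂ a) b) (Σ (suc n) G) ⟩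
    binomialSum n (∂ a) b + (H 0 + Σ (suc n) G)
      ≡⟨ cong (λ t → binomialSum n (∂ a) b + t) split-off-0 ⟨
    binomialSum n (∂ a) b + binomialSum n a (∂ b) ∎
    where
    H G : ℕ → ℚ
    H j = ℕ→ℚ (n C j) * a j * b (suc n ∸ j)
    G j = ℕ→ℚ (n C suc j) * a (suc j) * b (n ∸ j)
    x+[y+z]≡y+[x+z] : ∀ x y z → x + (y + z) ≡ y + (x + z)
    x+[y+z]≡y+[x+z] = solve-∀ ℚ-ring
    [p+q]xy≡pxy+qxy : ∀ p q x y → (p + q) * x * y ≡ p * x * y + q * x * y
    [p+q]xy≡pxy+qxy = solve-∀ ℚ-ring
    pascal : ∀ j → ℕ→ℚ (suc n C suc j) * a (suc j) * b (n ∸ j) ≡ ℕ→ℚ (n C j) * a (suc j) * b (n ∸ j) + G j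
    pascal j = begin
      ℕ→ℚ (suc n C suc j) * a (suc j) * b (n ∸ j)
        ≡⟨ cong (λ t → ℕ→ℚ t * a (suc j) * b (n ∸ j)) (nCk+nC[k+1]≡[n+1]C[k+1] n j) ⟨
      ℕ→ℚ (n C j ℕ.+ n C suc j) * a (suc j) * b (n ∸ j)
        ≡⟨ cong (λ t → t * a (suc j) * b (n ∸ j)) (ℕ→ℚ-homo-+ (n C j) (n C suc j)) ⟩
      (ℕ→ℚ (n C j) + ℕ→ℚ (n C suc j)) * a (suc j) * b (n ∸ j)
        ≡⟨ [p+q]xy≡pxy+qxy (ℕ→ℚ (n C j)) (ℕ→ℚ (n C suc j)) (a (suc j)) (b (n ∸ j)) ⟩
      ℕ→ℚ (n C j) * a (suc j) * b (n ∸ j) + G j ∎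
    split-off-0 : binomialSum n a (∂ b) ≡ H 0 + Σ (suc n) G
    split-off-0 = begin
      binomialSum n a (∂ b)
        ≡⟨ Σ-cong-< (suc n) (λ j j≤n → cong (λ t → ℕ→ℚ (n C j) * a j * b t) (ℕP.+-∸-assoc 1 (ℕP.≤-pred j≤n))) ⟨
      Σ (suc n) H
        ≡⟨ ℚP.+-identityʳ _ ⟨
      Σ (suc n) H + 0ℚ
        ≡⟨ cong (λ t → Σ (suc n) H + t) H[n+1]≡0 ⟨
      Σ (suc n) H + H (suc n)
        ≡⟨ Σ-snoc (suc n) H ⟨
      H 0 + Σ (suc n) G ∎
      where
      H[n+1]≡0 : H (suc n) ≡ 0ℚ
      H[n+1]≡0 = begin
        ℕ→ℚ (n C suc n) * a (suc n) * b (n ∸ n)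
          ≡⟨ cong (λ t → ℕ→ℚ t * a (suc n) * b (n ∸ n)) (k>n⇒nCk≡0 (ℕP.n<1+n n)) ⟩
        0ℚ * a (suc n) * b (n ∸ n)              ≡⟨ cong (_* b (n ∸ n)) (ℚP.*-zeroˡ (a (suc n))) ⟩
        0ℚ * b (n ∸ n)                          ≡⟨ ℚP.*-zeroˡ (b (n ∸ n)) ⟩
        0ℚ                                      ∎

  conv≡binomialSum : ∀ n a b → conv n a b ≡ binomialSum n a b
  conv≡binomialSum zero    a b = xy≡1xy+0 (a 0) (b 0)
    where
    xy≡1xy+0 : ∀ x y → x * y ≡ 1ℚ * x * y + 0ℚ
    xy≡1xy+0 = solve-∀ ℚ-ring
  conv≡binomialSum (suc n) a b = trans (cong₂ _+_ (conv≡binomialSum n (∂ a) b) (conv≡binomialSum n a (∂ b)))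
                                       (sym (binomialSum-suc n a b))

  isum-snoc : ∀ l v i f → isum (l ++ [ v ]) i f ≡ isum l i f + f (i ℕ.+ length l) v
  isum-snoc []       v i f = trans (ℚP.+-identityʳ (f i v)) (trans (cong (λ t → f t v) (sym (ℕP.+-identityʳ i)))
                                                                  (sym (ℚP.+-identityˡ _)))
  isum-snoc (b ∷ bs) v i f = begin
    f i b + isum (bs ++ [ v ]) (suc i) f                  ≡⟨ cong (λ t → f i b + t) (isum-snoc bs v (suc i) f) ⟩
    f i b + (isum bs (suc i) f + f (suc i ℕ.+ length bs) v) ≡⟨ ℚP.+-assoc (f i b) _ _ ⟨
    (f i b + isum bs (suc i) f) + f (suc i ℕ.+ length bs) v
      ≡⟨ cong (λ j → (f i b + isum bs (suc i) f) + f j v) (ℕP.+-suc i (length bs)) ⟨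
    (f i b + isum bs (suc i) f) + f (i ℕ.+ suc (length bs)) v ∎

  nth-snoc : ∀ l v → nth (l ++ [ v ]) (length l) ≡ v
  nth-snoc []       v = refl
  nth-snoc (b ∷ bs) v = nth-snoc bs v

  nextBernoulli : ℕ → ℚ
  nextBernoulli n = - (((+ 1) ℚ./ suc (suc n)) * isum (bernList n) 0 (λ j b → ℕ→ℚ (suc (suc n) C j) * b))

  length-bernList : ∀ n → length (bernList n) ≡ suc n
  length-bernList zero    = refl
  length-bernList (suc n) = trans (ListP.length-++ (bernList n))
                                  (trans (cong (ℕ._+ 1) (length-bernList n)) (ℕP.+-comm (suc n) 1))

  bernoulli-suc : ∀ n → bernoulli (suc n) ≡ nextBernoulli n
  bernoulli-suc n = trans (cong (nth (bernList (suc n))) (sym (length-bernList n))) (nth-snoc (bernList n) (nextBernoulli n))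

  isum-bernList : ∀ n f → isum (bernList n) 0 f ≡ Σ (suc n) (λ j → f j (bernoulli j))
  isum-bernList zero    f = refl
  isum-bernList (suc n) f = begin
    isum (bernList n ++ [ nextBernoulli n ]) 0 f
      ≡⟨ isum-snoc (bernList n) (nextBernoulli n) 0 f ⟩
    isum (bernList n) 0 f + f (length (bernList n)) (nextBernoulli n)
      ≡⟨ cong₂ _+_ (isum-bernList n f) (cong₂ f (length-bernList n) (sym (bernoulli-suc n))) ⟩
    Σ (suc n) (λ j → f j (bernoulli j)) + f (suc n) (bernoulli (suc n))
      ≡⟨ Σ-snoc (suc n) (λ j → f j (bernoulli j)) ⟨
    Σ (suc (suc n)) (λ j → f j (bernoulli j)) ∎

  [n+1]Cn≡n+1 : ∀ n → suc n C n ≡ suc n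
  [n+1]Cn≡n+1 n = trans (nCk≡nC[n∸k] (ℕP.n≤1+n n)) (trans (cong (suc n C_) (ℕP.m+n∸n≡m 1 n)) (nC1≡n (suc n)))

  bernoulli-recurrence : ∀ n → Σ (suc (suc n)) (λ j → ℕ→ℚ (suc (suc n) C j) * bernoulli j) ≡ 0ℚ
  bernoulli-recurrence n = begin
    Σ (suc (suc n)) F
      ≡⟨ Σ-snoc (suc n) F ⟩
    X + ℕ→ℚ (N C suc n) * bernoulli (suc n)
      ≡⟨ cong₂ (λ c b → X + ℕ→ℚ c * b) ([n+1]Cn≡n+1 (suc n)) (bernoulli-suc n) ⟩
    X + ℕ→ℚ N * nextBernoulli n
      ≡⟨ cong (λ t → X + ℕ→ℚ N * - (I * t)) (isum-bernList n (λ j b → ℕ→ℚ (N C j) * b)) ⟩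
    X + ℕ→ℚ N * - (I * X)
      ≡⟨ x+N[-[Ix]]≡x-[NI]x X (ℕ→ℚ N) I ⟩
    X - ℕ→ℚ N * I * X
      ≡⟨ cong (λ t → X - t * X) (ℕ→ℚ*1÷ℕ (suc n)) ⟩
    X - 1ℚ * X
      ≡⟨ x-1x≡0 X ⟩
    0ℚ ∎
    where
    N : ℕ
    N = suc (suc n)
    F : ℕ → ℚ
    F j = ℕ→ℚ (N C j) * bernoulli j
    X I : ℚ
    X = Σ (suc n) F
    I = (+ 1) ÷ℕ N
    x+N[-[Ix]]≡x-[NI]x : ∀ x N I → x + N * - (I * x) ≡ x - N * I * x
    x+N[-[Ix]]≡x-[NI]x = solve-∀ ℚ-ring
    x-1x≡0 : ∀ x → x - 1ℚ * x ≡ 0ℚ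
    x-1x≡0 = solve-∀ ℚ-ring

  ones : Seq
  ones = powℚ 1ℚ

  ones≡1 : ∀ m → ones m ≡ 1ℚ
  ones≡1 zero    = refl
  ones≡1 (suc m) = trans (ℚP.*-identityˡ _) (ones≡1 m)

  δ₁ : Seq
  δ₁ 1 = 1ℚ
  δ₁ _ = 0ℚ

  conv-ones-binomial : ∀ n u → conv n u ones ≡ Σ (suc n) (λ j → ℕ→ℚ (n C j) * u j)
  conv-ones-binomial n u = trans (conv≡binomialSum n u ones)
    (Σ-cong (suc n) (λ j → trans (cong (ℕ→ℚ (n C j) * u j *_) (ones≡1 (n ∸ j))) (ℚP.*-identityʳ (ℕ→ℚ (n C j) * u j))))

  conv-bernoulli-ones : ∀ n → conv n bernoulli ones ≡ bernoulli n + δ₁ n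
  conv-bernoulli-ones zero          = refl
  conv-bernoulli-ones (suc zero)    = refl
  conv-bernoulli-ones (suc (suc m)) = begin
    conv N bernoulli ones                         ≡⟨ conv-ones-binomial N bernoulli ⟩
    Σ (suc N) F                                   ≡⟨ Σ-snoc N F ⟩
    Σ N F + ℕ→ℚ (N C N) * bernoulli N             ≡⟨ cong₂ (λ s c → s + ℕ→ℚ c * bernoulli N) (bernoulli-recurrence m) (nCn≡1 N) ⟩
    0ℚ + 1ℚ * bernoulli N                         ≡⟨ 0+1x≡x+0 (bernoulli N) ⟩
    bernoulli N + 0ℚ                              ∎
    where
    N : ℕ
    N = suc (suc m)
    F : ℕ → ℚ
    F j = ℕ→ℚ (N C j) * bernoulli j
    0+1x≡x+0 : ∀ x → 0ℚ + 1ℚ * x ≡ x + 0ℚ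
    0+1x≡x+0 = solve-∀ ℚ-ring

  conv-ones-fixed⇒0 : ∀ (u : Seq) → (∀ n → conv n u ones ≡ u n) → ∀ n → u n ≡ 0ℚ
  conv-ones-fixed⇒0 u fixed = <-rec (λ n → u n ≡ 0ℚ) step
    where
    step : ∀ n → (∀ {j} → j ℕ.< n → u j ≡ 0ℚ) → u n ≡ 0ℚ
    step n below = begin
      u n              ≡⟨ ℚP.*-identityˡ (u n) ⟨
      1ℚ * u n         ≡⟨ cong (_* u n) (trans (ℚP.*-comm I N) (ℕ→ℚ*1÷ℕ n)) ⟨
      (I * N) * u n    ≡⟨ ℚP.*-assoc I N (u n) ⟩
      I * (N * u n)    ≡⟨ cong (I *_) Nu≡0 ⟩
      I * 0ℚ           ≡⟨ ℚP.*-zeroʳ I ⟩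
      0ℚ               ∎
      where
      N I : ℚ
      N = ℕ→ℚ (suc n)
      I = (+ 1) ÷ℕ suc n
      F : ℕ → ℚ
      F j = ℕ→ℚ (suc n C j) * u j
      Nu≡0 : N * u n ≡ 0ℚ
      Nu≡0 = +-identityˡ-unique (N * u n) (u (suc n)) (begin
        N * u n + u (suc n)                 ≡⟨ cong₂ _+_ (cong (λ c → ℕ→ℚ c * u n) ([n+1]Cn≡n+1 n))
                                                         (ℚP.*-identityˡ (u (suc n))) ⟨
        F n + 1ℚ * u (suc n)                ≡⟨ cong (λ c → F n + ℕ→ℚ c * u (suc n)) (nCn≡1 (suc n)) ⟨
        F n + F (suc n)                     ≡⟨ ℚP.+-identityˡ _ ⟨
        0ℚ + (F n + F (suc n))              ≡⟨ cong (_+ (F n + F (suc n))) (Σ-≈0 n (λ j j<n → lower-terms j j<n)) ⟨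
        Σ n F + (F n + F (suc n))           ≡⟨ ℚP.+-assoc (Σ n F) (F n) (F (suc n)) ⟨
        (Σ n F + F n) + F (suc n)           ≡⟨ cong (_+ F (suc n)) (Σ-snoc n F) ⟨
        Σ (suc n) F + F (suc n)             ≡⟨ Σ-snoc (suc n) F ⟨
        Σ (suc (suc n)) F                   ≡⟨ conv-ones-binomial (suc n) u ⟨
        conv (suc n) u ones                 ≡⟨ fixed (suc n) ⟩
        u (suc n)                           ∎)
        where
        lower-terms : ∀ j → j ℕ.< n → F j ≡ 0ℚ
        lower-terms j j<n = trans (cong (ℕ→ℚ (suc n C j) *_) (below j<n)) (ℚP.*-zeroʳ (ℕ→ℚ (suc n C j)))

  conv-ones-affine-unique : ∀ (u v w : Seq) → (∀ n → conv n u ones ≡ u n + w n) → (∀ n → conv n v ones ≡ v n + w n) →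
                            ∀ n → u n ≡ v n
  conv-ones-affine-unique u v w u-affine v-affine n = begin
    u n              ≡⟨ x≡[x-y]+y (u n) (v n) ⟩
    d n + v n        ≡⟨ cong (_+ v n) (conv-ones-fixed⇒0 d d-fixed n) ⟩
    0ℚ + v n         ≡⟨ ℚP.+-identityˡ (v n) ⟩
    v n              ∎
    where
    d : Seq
    d m = u m + - 1ℚ * v m
    x≡[x-y]+y : ∀ x y → x ≡ (x + - 1ℚ * y) + y
    x≡[x-y]+y = solve-∀ ℚ-ring
    cancel-w : ∀ x y z → (x + z) + - 1ℚ * (y + z) ≡ x + - 1ℚ * y
    cancel-w = solve-∀ ℚ-ring
    d-fixed : ∀ m → conv m d ones ≡ d m
    d-fixed m = begin
      conv m d ones                                         ≡⟨ conv-+ˡ m u _ ones ⟩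
      conv m u ones + conv m (λ i → - 1ℚ * v i) ones        ≡⟨ cong (λ t → conv m u ones + t) (conv-*ˡ m (- 1ℚ) v ones) ⟩
      conv m u ones + - 1ℚ * conv m v ones                  ≡⟨ cong₂ (λ s t → s + - 1ℚ * t) (u-affine m) (v-affine m) ⟩
      (u m + w m) + - 1ℚ * (v m + w m)                      ≡⟨ cancel-w (u m) (v m) (w m) ⟩
      d m                                                   ∎

  alternate-δ₁ : ∀ m → alternate δ₁ m ≡ - δ₁ m
  alternate-δ₁ zero          = refl
  alternate-δ₁ (suc zero)    = refl
  alternate-δ₁ (suc (suc m)) = ℚP.*-zeroʳ (sgnℚ (suc (suc m)))

  -- Both sides u satisfy conv n u ones ≡ u n + conv n δ₁ ones, which determines u.
  alternate-bernoulli : ∀ n → alternate bernoulli n ≡ bernoulli n + δ₁ n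
  alternate-bernoulli = conv-ones-affine-unique (alternate bernoulli) (λ n → bernoulli n + δ₁ n) (λ n → conv n δ₁ ones)
    alternate-affine bernoulli+δ₁-affine
    where
    conv-alternating-ones : ∀ m → conv m (alternate bernoulli) (powℚ (- 1ℚ)) + δ₁ m ≡ alternate bernoulli m
    conv-alternating-ones m = begin
      conv m (alternate bernoulli) (powℚ (- 1ℚ)) + δ₁ m
        ≡⟨ cong (_+ δ₁ m) (conv-cong m (λ _ → refl) (λ i → sym (alternate-powers 1ℚ i))) ⟩
      conv m (alternate bernoulli) (alternate ones) + δ₁ m
        ≡⟨ cong (_+ δ₁ m) (trans (conv-alternate m bernoulli ones) (cong (sgnℚ m *_) (conv-bernoulli-ones m))) ⟩
      sgnℚ m * (bernoulli m + δ₁ m) + δ₁ m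
        ≡⟨ cong (_+ δ₁ m) (trans (ℚP.*-distribˡ-+ (sgnℚ m) _ _) (cong (λ t → alternate bernoulli m + t) (alternate-δ₁ m))) ⟩
      (alternate bernoulli m + - δ₁ m) + δ₁ m
        ≡⟨ [x-y]+y≡x (alternate bernoulli m) (δ₁ m) ⟩
      alternate bernoulli m ∎
      where
      [x-y]+y≡x : ∀ x y → (x + - y) + y ≡ x
      [x-y]+y≡x = solve-∀ ℚ-ring
    alternate-affine : ∀ n → conv n (alternate bernoulli) ones ≡ alternate bernoulli n + conv n δ₁ ones
    alternate-affine n = begin
      conv n (alternate bernoulli) ones
        ≡⟨ conv-cong n (λ m → sym (conv-alternating-ones m)) (λ _ → refl) ⟩
      conv n (λ m → conv m (alternate bernoulli) (powℚ (- 1ℚ)) + δ₁ m) ones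
        ≡⟨ conv-+ˡ n _ δ₁ ones ⟩
      conv n (λ m → conv m (alternate bernoulli) (powℚ (- 1ℚ))) ones + conv n δ₁ ones
        ≡⟨ cong (_+ conv n δ₁ ones) (conv-assoc n (alternate bernoulli) (powℚ (- 1ℚ)) ones) ⟩
      conv n (alternate bernoulli) (λ m → conv m (powℚ (- 1ℚ)) ones) + conv n δ₁ ones
        ≡⟨ cong (_+ conv n δ₁ ones) (conv-cong n (λ _ → refl) (λ m → conv-powers m (- 1ℚ) 1ℚ)) ⟩
      conv n (alternate bernoulli) (powℚ 0ℚ) + conv n δ₁ ones
        ≡⟨ cong (_+ conv n δ₁ ones) (trans (conv-comm n (alternate bernoulli) (powℚ 0ℚ)) (conv-identityˡ n (alternate bernoulli))) ⟩
      alternate bernoulli n + conv n δ₁ ones ∎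
    bernoulli+δ₁-affine : ∀ n → conv n (λ m → bernoulli m + δ₁ m) ones ≡ (bernoulli n + δ₁ n) + conv n δ₁ ones
    bernoulli+δ₁-affine n = trans (conv-+ˡ n bernoulli δ₁ ones) (cong (_+ conv n δ₁ ones) (conv-bernoulli-ones n))

  bernPoly≡conv : ∀ n x → bernPoly n x ≡ conv n bernoulli (powℚ x)
  bernPoly≡conv n x = trans (isum-bernList n (λ j b → ℕ→ℚ (n C j) * b * powℚ x (n ∸ j)))
                            (sym (conv≡binomialSum n bernoulli (powℚ x)))

  bernPoly-reflect : ∀ n t → bernPoly n (1ℚ - t) ≡ sgnℚ n * bernPoly n t
  bernPoly-reflect n t = begin
    bernPoly n (1ℚ - t)                                  ≡⟨ bernPoly≡conv n (1ℚ - t) ⟩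
    conv n bernoulli (powℚ (1ℚ - t))                     ≡⟨ conv-cong n (λ _ → refl) (λ m → conv-powers m 1ℚ (- t)) ⟨
    conv n bernoulli (λ m → conv m ones (powℚ (- t)))     ≡⟨ conv-assoc n bernoulli ones (powℚ (- t)) ⟨
    conv n (λ m → conv m bernoulli ones) (powℚ (- t))     ≡⟨ conv-cong n (λ m → trans (conv-bernoulli-ones m) (sym (alternate-bernoulli m)))
                                                                          (λ m → sym (alternate-powers t m)) ⟩
    conv n (alternate bernoulli) (alternate (powℚ t))     ≡⟨ conv-alternate n bernoulli (powℚ t) ⟩
    sgnℚ n * conv n bernoulli (powℚ t)                    ≡⟨ cong (sgnℚ n *_) (bernPoly≡conv n t) ⟨
    sgnℚ n * bernPoly n t                                 ∎

  bernPoly-0-reflect : ∀ n → bernPoly (suc (suc n)) 0ℚ ≡ sgnℚ (suc (suc n)) * bernPoly (suc (suc n)) 0ℚ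
  bernPoly-0-reflect n = begin
    bernPoly N 0ℚ                        ≡⟨ bernPoly≡conv N 0ℚ ⟩
    conv N bernoulli (powℚ 0ℚ)           ≡⟨ trans (conv-comm N bernoulli (powℚ 0ℚ)) (conv-identityˡ N bernoulli) ⟩
    bernoulli N                          ≡⟨ ℚP.+-identityʳ (bernoulli N) ⟨
    bernoulli N + δ₁ N                   ≡⟨ conv-bernoulli-ones N ⟨
    conv N bernoulli (powℚ (1ℚ - 0ℚ))    ≡⟨ bernPoly≡conv N (1ℚ - 0ℚ) ⟨
    bernPoly N (1ℚ - 0ℚ)                 ≡⟨ bernPoly-reflect N 0ℚ ⟩
    sgnℚ N * bernPoly N 0ℚ               ∎
    where
    N : ℕ
    N = suc (suc n)

module BernoulliFunction where
  open import Data.Integer.Base using (_≤_; _<_)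
  open import Data.Rational.Base using (_+_; _*_; -_; _-_)
  open ℚP using (_≟_)
  open P using (refl; cong; sym; trans; subst; subst₂)
  open P.≡-Reasoning
  open RingProperties (CommutativeRing.ring ℚP.+-*-commutativeRing) using (-1*x≈-x; -‿involutive)
  open BernoulliPolynomials using (ℚ-ring; sgnℚ; bernPoly-reflect; bernPoly-0-reflect)

  <-suc⇒≤ : ∀ {a b} → a < ℤ.suc b → a ≤ b
  <-suc⇒≤ {a} {b} a<1+b = subst₂ _≤_ (ℤP.pred-suc a) (ℤP.pred-suc b) (ℤP.pred-mono (ℤP.i<j⇒suc[i]≤j a<1+b))

  floor*↧≤↥ : ∀ x → floor x ℤ.* ↧ x ≤ ↥ x
  floor*↧≤↥ (mkℚ n d _) = ℤD.[n/d]*d≤n n (+ suc d)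

  ↥<[floor+1]*↧ : ∀ x → ↥ x < ℤ.suc (floor x) ℤ.* ↧ x
  ↥<[floor+1]*↧ (mkℚ n d _) = subst (λ t → n < ℤ.suc t ℤ.* + suc d) (sym (ℤD.div-pos-is-/ℕ n (suc d)))
                                    (ℤD.n<s[n/ℕd]*d n (suc d))

  floor-unique : ∀ y N D z → ↥ y ℤ.* + suc D ≡ N ℤ.* ↧ y →
                 z ℤ.* + suc D ≤ N → N < ℤ.suc z ℤ.* + suc D → floor y ≡ z
  floor-unique y N D z y≡N/D zD≤N N<[z+1]D = ℤP.≤-antisym (<-suc⇒≤ f<z+1) (<-suc⇒≤ z<f+1)
    where
    swap : ∀ a b c → (a ℤ.* b) ℤ.* c ≡ (a ℤ.* c) ℤ.* b
    swap = ℤ-solve-∀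
    z↧≤↥ : z ℤ.* ↧ y ≤ ↥ y
    z↧≤↥ = ℤP.*-cancelʳ-≤-pos (z ℤ.* ↧ y) (↥ y) (+ suc D)
      (subst₂ _≤_ (swap z (+ suc D) (↧ y)) (sym y≡N/D) (ℤP.*-monoʳ-≤-nonNeg (↧ y) zD≤N))
    ↥<[z+1]↧ : ↥ y < ℤ.suc z ℤ.* ↧ y
    ↥<[z+1]↧ = ℤP.*-cancelʳ-<-nonNeg (+ suc D)
      (subst₂ _<_ (sym y≡N/D) (swap (ℤ.suc z) (+ suc D) (↧ y)) (ℤP.*-monoʳ-<-pos (↧ y) N<[z+1]D))
    f<z+1 : floor y < ℤ.suc z
    f<z+1 = ℤP.*-cancelʳ-<-nonNeg (↧ y) (ℤP.≤-<-trans (floor*↧≤↥ y) ↥<[z+1]↧)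
    z<f+1 : z < ℤ.suc (floor y)
    z<f+1 = ℤP.*-cancelʳ-<-nonNeg (↧ y) (ℤP.≤-<-trans z↧≤↥ (↥<[floor+1]*↧ y))

  floor-+ℤ : ∀ x z → floor (x + ℤ→ℚ z) ≡ floor x ℤ.+ z
  floor-+ℤ x@(mkℚ n d _) z = floor-unique (x + ℤ→ℚ z) (n ℤ.+ z ℤ.* + suc d) d (floor x ℤ.+ z) x+z≡ lower upper
    where
    cross : ∀ n z d → (n ℤ.* + 1 ℤ.+ z ℤ.* d) ℤ.* d ≡ (n ℤ.+ z ℤ.* d) ℤ.* (d ℤ.* + 1)
    cross = ℤ-solve-∀
    x+z≃ : toℚᵘ (x + ℤ→ℚ z) ℚᵘ.≃ ℚᵘ.mkℚᵘ (n ℤ.+ z ℤ.* + suc d) d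
    x+z≃ = ℚᵘP.≃-trans (ℚP.toℚᵘ-homo-+ x (ℤ→ℚ z))
             (ℚᵘP.≃-trans (ℚᵘP.+-cong (ℚᵘP.≃-refl {ℚᵘ.mkℚᵘ n d}) (ℚP.toℚᵘ-fromℚᵘ (ℚᵘ.mkℚᵘ z 0)))
                          (ℚᵘ.*≡* (cross n z (+ suc d))))
    x+z≡ : ↥ (x + ℤ→ℚ z) ℤ.* + suc d ≡ (n ℤ.+ z ℤ.* + suc d) ℤ.* ↧ (x + ℤ→ℚ z)
    x+z≡ with x+z≃
    ... | ℚᵘ.*≡* eq = subst₂ (λ a b → a ℤ.* + suc d ≡ (n ℤ.+ z ℤ.* + suc d) ℤ.* b)
                             (ℚP.↥ᵘ-toℚᵘ (x + ℤ→ℚ z)) (ℚP.↧ᵘ-toℚᵘ (x + ℤ→ℚ z)) eq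
    distrib : ∀ f z d → f ℤ.* d ℤ.+ z ℤ.* d ≡ (f ℤ.+ z) ℤ.* d
    distrib = ℤ-solve-∀
    distrib-suc : ∀ f z d → (+ 1 ℤ.+ f) ℤ.* d ℤ.+ z ℤ.* d ≡ (+ 1 ℤ.+ (f ℤ.+ z)) ℤ.* d
    distrib-suc = ℤ-solve-∀
    lower : (floor x ℤ.+ z) ℤ.* + suc d ≤ n ℤ.+ z ℤ.* + suc d
    lower = subst (_≤ n ℤ.+ z ℤ.* + suc d) (distrib (floor x) z (+ suc d)) (ℤP.+-monoˡ-≤ (z ℤ.* + suc d) (floor*↧≤↥ x))
    upper : n ℤ.+ z ℤ.* + suc d < ℤ.suc (floor x ℤ.+ z) ℤ.* + suc d
    upper = subst (n ℤ.+ z ℤ.* + suc d <_) (distrib-suc (floor x) z (+ suc d)) (ℤP.+-monoˡ-< (z ℤ.* + suc d) (↥<[floor+1]*↧ x))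

  frac-+ℤ : ∀ x z → frac (x + ℤ→ℚ z) ≡ frac x
  frac-+ℤ x z = begin
    (x + ℤ→ℚ z) - ℤ→ℚ (floor (x + ℤ→ℚ z))   ≡⟨ cong (λ t → (x + ℤ→ℚ z) - ℤ→ℚ t) (floor-+ℤ x z) ⟩
    (x + ℤ→ℚ z) - ℤ→ℚ (floor x ℤ.+ z)       ≡⟨ cong (λ t → (x + ℤ→ℚ z) - t) (ℤ→ℚ-homo-+ (floor x) z) ⟩
    (x + ℤ→ℚ z) - (ℤ→ℚ (floor x) + ℤ→ℚ z)   ≡⟨ [x+b]-[a+b]≡x-a x (ℤ→ℚ (floor x)) (ℤ→ℚ z) ⟩
    x - ℤ→ℚ (floor x)                       ∎
    where
    [x+b]-[a+b]≡x-a : ∀ x a b → (x + b) - (a + b) ≡ x - a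
    [x+b]-[a+b]≡x-a = solve-∀ ℚ-ring

  frac≡0⇒≡floor : ∀ x → frac x ≡ 0ℚ → x ≡ ℤ→ℚ (floor x)
  frac≡0⇒≡floor x frac≡0 = begin
    x                               ≡⟨ x≡[x-a]+a x (ℤ→ℚ (floor x)) ⟩
    frac x + ℤ→ℚ (floor x)          ≡⟨ cong (_+ ℤ→ℚ (floor x)) frac≡0 ⟩
    0ℚ + ℤ→ℚ (floor x)              ≡⟨ ℚP.+-identityˡ _ ⟩
    ℤ→ℚ (floor x)                   ∎
    where
    x≡[x-a]+a : ∀ x a → x ≡ (x - a) + a
    x≡[x-a]+a = solve-∀ ℚ-ring

  frac-neg-integer : ∀ x → frac x ≡ 0ℚ → frac (- x) ≡ 0ℚ
  frac-neg-integer x frac≡0 = trans (cong frac -x≡0+z) (frac-+ℤ 0ℚ (ℤ.- floor x))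
    where
    -x≡0+z : - x ≡ 0ℚ + ℤ→ℚ (ℤ.- floor x)
    -x≡0+z = trans (cong -_ (frac≡0⇒≡floor x frac≡0))
                   (trans (sym (ℤ→ℚ-homo‿- (floor x))) (sym (ℚP.+-identityˡ _)))

  frac-neg : ∀ x → ¬ (frac x ≡ 0ℚ) → frac (- x) ≡ 1ℚ - frac x
  frac-neg x@(mkℚ n d _) frac≢0 = begin
    - x - ℤ→ℚ (floor (- x))           ≡⟨ cong (λ t → - x - ℤ→ℚ t) floor-neg ⟩
    - x - ℤ→ℚ (ℤ.- ℤ.suc f)
      ≡⟨ cong (λ t → - x - t) (trans (ℤ→ℚ-homo‿- (ℤ.suc f)) (cong -_ (ℤ→ℚ-homo-+ (+ 1) f))) ⟩
    - x - (- (1ℚ + ℤ→ℚ f))            ≡⟨ -x+[1+a]≡1-[x-a] x (ℤ→ℚ f) ⟩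
    1ℚ - (x - ℤ→ℚ f)                  ∎
    where
    f : ℤ
    f = floor x
    -x+[1+a]≡1-[x-a] : ∀ x a → - x - (- (1ℚ + a)) ≡ 1ℚ - (x - a)
    -x+[1+a]≡1-[x-a] = solve-∀ ℚ-ring
    fd≢n : ¬ (f ℤ.* + suc d ≡ n)
    fd≢n fd≡n = frac≢0 (trans (cong (_- ℤ→ℚ f) x≡f) (ℚP.+-inverseʳ (ℤ→ℚ f)))
      where
      x≡f : x ≡ ℤ→ℚ f
      x≡f = trans (sym (ℚP.fromℚᵘ-toℚᵘ x))
                  (fromℚᵘ-≃ (ℚᵘ.mkℚᵘ n d) (ℚᵘ.mkℚᵘ f 0) (ℚᵘ.*≡* (trans (ℤP.*-identityʳ n) (sym fd≡n))))
    neg-distrib : ∀ f d → ℤ.- (f ℤ.* d) ≡ (+ 1 ℤ.+ (ℤ.- (+ 1 ℤ.+ f))) ℤ.* d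
    neg-distrib = ℤ-solve-∀
    neg-distrib-suc : ∀ f d → ℤ.- ((+ 1 ℤ.+ f) ℤ.* d) ≡ (ℤ.- (+ 1 ℤ.+ f)) ℤ.* d
    neg-distrib-suc = ℤ-solve-∀
    floor-neg : floor (- x) ≡ ℤ.- ℤ.suc f
    floor-neg = floor-unique (- x) (ℤ.- n) d (ℤ.- ℤ.suc f)
      (subst₂ (λ a b → a ℤ.* + suc d ≡ ℤ.- n ℤ.* b) (sym (ℚP.↥-neg x)) (sym (ℚP.↧-neg x)) refl)
      (subst (_≤ ℤ.- n) (neg-distrib-suc f (+ suc d)) (ℤP.neg-mono-≤ (ℤP.<⇒≤ (↥<[floor+1]*↧ x))))
      (subst (ℤ.- n <_) (neg-distrib f (+ suc d)) (ℤP.neg-mono-< (ℤP.≤∧≢⇒< (floor*↧≤↥ x) fd≢n)))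

  frac-neg≢0 : ∀ x → ¬ (frac x ≡ 0ℚ) → ¬ (frac (- x) ≡ 0ℚ)
  frac-neg≢0 x frac≢0 frac-x≡0 = frac≢0 (subst (λ t → frac t ≡ 0ℚ) (-‿involutive x) (frac-neg-integer (- x) frac-x≡0))

  bernFun₀₁ : ℕ → ℚ → ℚ
  bernFun₀₁ 1 t with t ≟ 0ℚ
  ... | yes _ = 0ℚ
  ... | no  _ = bernPoly 1 t
  bernFun₀₁ n t = bernPoly n t

  bernFun≡bernFun₀₁∘frac : ∀ p x → bernFun p x ≡ bernFun₀₁ p (frac x)
  bernFun≡bernFun₀₁∘frac 0 x = refl
  bernFun≡bernFun₀₁∘frac 1 x with frac x ≟ 0ℚ
  ... | yes _ = refl
  ... | no  _ = refl
  bernFun≡bernFun₀₁∘frac (suc (suc n)) x = refl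

  bernFun₀₁≡bernPoly : ∀ p t → ¬ (t ≡ 0ℚ) → bernFun₀₁ p t ≡ bernPoly p t
  bernFun₀₁≡bernPoly 0 t t≢0 = refl
  bernFun₀₁≡bernPoly 1 t t≢0 with t ≟ 0ℚ
  ... | yes t≡0 = ⊥-elim (t≢0 t≡0)
  ... | no  _   = refl
  bernFun₀₁≡bernPoly (suc (suc n)) t t≢0 = refl

  bernFun-+ℤ : ∀ p x z → bernFun p (x + ℤ→ℚ z) ≡ bernFun p x
  bernFun-+ℤ p x z = trans (bernFun≡bernFun₀₁∘frac p (x + ℤ→ℚ z))
                           (trans (cong (bernFun₀₁ p) (frac-+ℤ x z)) (sym (bernFun≡bernFun₀₁∘frac p x)))

  sgnℚ-odd : ∀ p → ¬ (2 ∣ p) → sgnℚ p ≡ - 1ℚ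
  sgnℚ-odd 0             p-odd = ⊥-elim (p-odd (2 ℕD.∣0))
  sgnℚ-odd 1             p-odd = refl
  sgnℚ-odd (suc (suc p)) p-odd = trans (-‿involutive (sgnℚ p)) (sgnℚ-odd p (p-odd ∘ ℕD.∣m∣n⇒∣m+n (ℕD.∣-refl {2})))

  bernFun-neg : ∀ p x → ¬ (2 ∣ p) → bernFun p (- x) ≡ - bernFun p x
  bernFun-neg p x p-odd with frac x ≟ 0ℚ
  bernFun-neg 0 x p-odd | _ = ⊥-elim (p-odd (2 ℕD.∣0))
  bernFun-neg 1 x p-odd | yes frac≡0 = begin
    bernFun 1 (- x)                  ≡⟨ bernFun≡bernFun₀₁∘frac 1 (- x) ⟩
    bernFun₀₁ 1 (frac (- x))         ≡⟨ cong (bernFun₀₁ 1) (frac-neg-integer x frac≡0) ⟩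
    0ℚ                               ≡⟨ cong (λ t → - bernFun₀₁ 1 t) frac≡0 ⟨
    - bernFun₀₁ 1 (frac x)           ≡⟨ cong -_ (bernFun≡bernFun₀₁∘frac 1 x) ⟨
    - bernFun 1 x                    ∎
  bernFun-neg (suc (suc m)) x p-odd | yes frac≡0 = begin
    bernPoly N (frac (- x))          ≡⟨ cong (bernPoly N) (frac-neg-integer x frac≡0) ⟩
    bernPoly N 0ℚ                    ≡⟨ bernPoly-0-reflect m ⟩
    sgnℚ N * bernPoly N 0ℚ           ≡⟨ cong (_* bernPoly N 0ℚ) (sgnℚ-odd N p-odd) ⟩
    - 1ℚ * bernPoly N 0ℚ             ≡⟨ -1*x≈-x (bernPoly N 0ℚ) ⟩
    - bernPoly N 0ℚ                  ≡⟨ cong (λ t → - bernPoly N t) frac≡0 ⟨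
    - bernPoly N (frac x)            ∎
    where
    N : ℕ
    N = suc (suc m)
  bernFun-neg p x p-odd | no frac≢0 = begin
    bernFun p (- x)                  ≡⟨ bernFun≡bernFun₀₁∘frac p (- x) ⟩
    bernFun₀₁ p (frac (- x))         ≡⟨ bernFun₀₁≡bernPoly p _ (frac-neg≢0 x frac≢0) ⟩
    bernPoly p (frac (- x))          ≡⟨ cong (bernPoly p) (frac-neg x frac≢0) ⟩
    bernPoly p (1ℚ - frac x)         ≡⟨ bernPoly-reflect p (frac x) ⟩
    sgnℚ p * bernPoly p (frac x)     ≡⟨ cong (_* bernPoly p (frac x)) (sgnℚ-odd p p-odd) ⟩
    - 1ℚ * bernPoly p (frac x)       ≡⟨ -1*x≈-x (bernPoly p (frac x)) ⟩
    - bernPoly p (frac x)            ≡⟨ cong -_ (bernFun₀₁≡bernPoly p _ frac≢0) ⟨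
    - bernFun₀₁ p (frac x)           ≡⟨ cong -_ (bernFun≡bernFun₀₁∘frac p x) ⟨
    - bernFun p x                    ∎

  ÷-shift : ∀ K J x m → (J + (x + ℤ→ℚ (m ℤ.* + suc K))) * ((+ 1) ÷ℕ suc K) ≡ (J + x) * ((+ 1) ÷ℕ suc K) + ℤ→ℚ m
  ÷-shift K J x m = begin
    (J + (x + ℤ→ℚ (m ℤ.* + suc K))) * u     ≡⟨ cong (λ t → (J + (x + t)) * u) (ℤ→ℚ-homo-* m (+ suc K)) ⟩
    (J + (x + ℤ→ℚ m * ℕ→ℚ (suc K))) * u     ≡⟨ expand J x (ℤ→ℚ m) (ℕ→ℚ (suc K)) u ⟩
    (J + x) * u + ℤ→ℚ m * (ℕ→ℚ (suc K) * u)  ≡⟨ cong (λ t → (J + x) * u + ℤ→ℚ m * t) (ℕ→ℚ*1÷ℕ K) ⟩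
    (J + x) * u + ℤ→ℚ m * 1ℚ                 ≡⟨ cong (λ t → (J + x) * u + t) (ℚP.*-identityʳ (ℤ→ℚ m)) ⟩
    (J + x) * u + ℤ→ℚ m                      ∎
    where
    u : ℚ
    u = (+ 1) ÷ℕ suc K
    expand : ∀ J x M K u → (J + (x + M * K)) * u ≡ (J + x) * u + M * (K * u)
    expand = solve-∀ ℚ-ring

  ÷-reflect : ∀ K j x m → j ℕ.≤ suc K →
    (ℕ→ℚ (suc K ∸ j) + (ℤ→ℚ (m ℤ.* + suc K) - x)) * ((+ 1) ÷ℕ suc K)
      ≡ - ((ℕ→ℚ j + x) * ((+ 1) ÷ℕ suc K)) + ℤ→ℚ (m ℤ.+ + 1)
  ÷-reflect K j x m j≤k = begin
    (J′ + (ℤ→ℚ (m ℤ.* + suc K) - x)) * u       ≡⟨ cong (λ t → (J′ + (t - x)) * u) (ℤ→ℚ-homo-* m (+ suc K)) ⟩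
    (J′ + (ℤ→ℚ m * k - x)) * u                  ≡⟨ expand J′ J k (ℤ→ℚ m) x u ⟩
    - w + (ℤ→ℚ m * (k * u) + (J′ + J) * u)      ≡⟨ cong (λ t → - w + (ℤ→ℚ m * (k * u) + t * u)) J′+J≡k ⟩
    - w + (ℤ→ℚ m * (k * u) + k * u)             ≡⟨ cong (λ t → - w + (ℤ→ℚ m * t + t)) (ℕ→ℚ*1÷ℕ K) ⟩
    - w + (ℤ→ℚ m * 1ℚ + 1ℚ)                     ≡⟨ cong (λ t → - w + (t + 1ℚ)) (ℚP.*-identityʳ (ℤ→ℚ m)) ⟩
    - w + (ℤ→ℚ m + ℤ→ℚ (+ 1))                   ≡⟨ cong (λ t → - w + t) (ℤ→ℚ-homo-+ m (+ 1)) ⟨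
    - w + ℤ→ℚ (m ℤ.+ + 1)                        ∎
    where
    u k J J′ w : ℚ
    u = (+ 1) ÷ℕ suc K
    k = ℕ→ℚ (suc K)
    J = ℕ→ℚ j
    J′ = ℕ→ℚ (suc K ∸ j)
    w = (J + x) * u
    J′+J≡k : J′ + J ≡ k
    J′+J≡k = trans (sym (ℕ→ℚ-homo-+ (suc K ∸ j) j)) (cong ℕ→ℚ (ℕP.m∸n+n≡m j≤k))
    expand : ∀ J′ J k M x u → (J′ + (M * k - x)) * u ≡ - ((J + x) * u) + (M * (k * u) + (J′ + J) * u)
    expand = solve-∀ ℚ-ring

coprime-∸ : ∀ {j k} → j ℕ.≤ k → Coprime j k → Coprime (k ∸ j) k
coprime-∸ {j} {k} j≤k j⊥k (i∣k-j , i∣k) =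
  j⊥k (ℕD.∣m+n∣m⇒∣n (P.subst (_ ∣_) (P.sym (ℕP.m∸n+n≡m j≤k)) i∣k) i∣k-j , i∣k)

∸-coprime : ∀ {j k} → j ℕ.≤ k → Coprime (k ∸ j) k → Coprime j k
∸-coprime {j} {k} j≤k k-j⊥k = P.subst (λ t → Coprime t k) (ℕP.m∸[m∸n]≡n j≤k) (coprime-∸ (ℕP.m∸n≤m k j) k-j⊥k)

module DirichletBernoulli {a ℓ : Level} (R : CommutativeRing a ℓ)
  (ι : ℚ → CommutativeRing.Carrier R)
  (ι-hom : IsRingHomomorphism +-*-rawRing (CommutativeRing.rawRing R) ι)
  (k₂ : ℕ) (χ χ̄ : ℕ → CommutativeRing.Carrier R)
  (χ-char : Char.IsDirichletCharacter R ι (2 ℕ.+ k₂) χ)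
  (χ̄-conj : Char.IsConjugate R ι (2 ℕ.+ k₂) χ χ̄)
  (p : ℕ) (p-odd : ¬ (2 ∣ p)) where

  open CommutativeRing R hiding (zero)
  open Char R ι
  open FiniteSum ring
  open RingProperties ring using (-‿distribʳ-*; -‿involutive)
  open CommutativeSemigroupProperties *-commutativeSemigroup using (interchange; x∙yz≈y∙xz)
  open SetoidReasoning setoid
  open BernoulliFunction using (bernFun-+ℤ; bernFun-neg; ÷-shift; ÷-reflect)
  open IsDirichletCharacter χ-char
  open IsRingHomomorphism ι-hom

  k : ℕ
  k = 2 ℕ.+ k₂

  halve : ∀ t → t + t ≈ 0# → t ≈ 0#
  halve t t+t≈0 = begin
    t                  ≈⟨ *-identityˡ t ⟨
    1# * t             ≈⟨ *-congʳ (trans (sym (+-homo ½ ½)) 1#-homo) ⟨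
    (ι ½ + ι ½) * t    ≈⟨ distribʳ t (ι ½) (ι ½) ⟩
    ι ½ * t + ι ½ * t  ≈⟨ distribˡ (ι ½) t t ⟨
    ι ½ * (t + t)      ≈⟨ *-congˡ t+t≈0 ⟩
    ι ½ * 0#           ≈⟨ zeroʳ (ι ½) ⟩
    0#                 ∎
    where
    ½ : ℚ
    ½ = (+ 1) ÷ℕ 2

  ∑₀≡Σ : ∀ N f → ∑₀ N f ≡ Σ N f
  ∑₀≡Σ zero    f = P.refl
  ∑₀≡Σ (suc N) f = P.cong (λ t → f 0 + t) (∑₀≡Σ N (f ∘ suc))

  χ-+-multiple : ∀ n v → χ (n ℕ.+ v ℕ.* k) ≈ χ n
  χ-+-multiple n zero    = reflexive (P.cong χ (ℕP.+-identityʳ n))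
  χ-+-multiple n (suc v) = trans (reflexive (P.cong χ (rearrange n v k))) (trans (periodic (n ℕ.+ v ℕ.* k)) (χ-+-multiple n v))
    where
    rearrange : ∀ n v k → n ℕ.+ (k ℕ.+ v ℕ.* k) ≡ (n ℕ.+ v ℕ.* k) ℕ.+ k
    rearrange = ℕ-solve-∀

  χ-cong-mod : ∀ a b e u v → a ℕ.+ e ≡ u ℕ.* k → b ℕ.+ e ≡ v ℕ.* k → χ a ≈ χ b
  χ-cong-mod a b e u v a+e≡uk b+e≡vk = begin
    χ a                ≈⟨ χ-+-multiple a v ⟨
    χ (a ℕ.+ v ℕ.* k)  ≡⟨ P.cong χ a+vk≡b+uk ⟩
    χ (b ℕ.+ u ℕ.* k)  ≈⟨ χ-+-multiple b u ⟩
    χ b                ∎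
    where
    swap : ∀ a b e → a ℕ.+ (b ℕ.+ e) ≡ b ℕ.+ (a ℕ.+ e)
    swap = ℕ-solve-∀
    a+vk≡b+uk : a ℕ.+ v ℕ.* k ≡ b ℕ.+ u ℕ.* k
    a+vk≡b+uk = P.trans (P.cong (λ t → a ℕ.+ t) (P.sym b+e≡vk)) (P.trans (swap a b e) (P.cong (λ t → b ℕ.+ t) a+e≡uk))

  χ-reflect : ∀ u n → n ℕ.≤ u ℕ.* k → χ (u ℕ.* k ∸ n) ≈ χ (k ∸ 1) * χ n
  χ-reflect u n n≤uk = trans (χ-cong-mod (u ℕ.* k ∸ n) ((k ∸ 1) ℕ.* n) n u n (ℕP.m∸n+n≡m n≤uk) ([k-1]n+n≡nk n k₂))
                             (multiplicative (k ∸ 1) n)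
    where
    [k-1]n+n≡nk : ∀ n k₂ → suc k₂ ℕ.* n ℕ.+ n ≡ n ℕ.* suc (suc k₂)
    [k-1]n+n≡nk = ℕ-solve-∀

  k-1⊥k : Coprime (k ∸ 1) k
  k-1⊥k = coprime-∸ (s≤s z≤n) (ℕC.1-coprimeTo k)

  χ̄χ[k-1]≈1 : χ̄ (k ∸ 1) * χ (k ∸ 1) ≈ 1#
  χ̄χ[k-1]≈1 = proj₁ χ̄-conj (k ∸ 1) k-1⊥k

  χ̄0≈0 : χ̄ 0 ≈ 0#
  χ̄0≈0 = proj₂ χ̄-conj 0 (λ 0⊥k → k≢1 (0⊥k (k ℕD.∣0 , ℕD.∣-refl)))
    where
    k≢1 : ¬ (k ≡ 1)
    k≢1 ()

  -- χ̄ is not assumed multiplicative: both sides are inverses of χ (k ∸ j), or both vanish.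
  χ̄-reflect : ∀ j → j ℕ.≤ k → χ̄ (k ∸ j) ≈ χ̄ (k ∸ 1) * χ̄ j
  χ̄-reflect j j≤k with coprime? j k
  ... | no ¬j⊥k = trans (proj₂ χ̄-conj (k ∸ j) (¬j⊥k ∘ ∸-coprime j≤k))
                        (sym (trans (*-congˡ (proj₂ χ̄-conj j ¬j⊥k)) (zeroʳ _)))
  ... | yes j⊥k = inverse-unique (χ (k ∸ j)) (trans (*-comm _ _) (proj₁ χ̄-conj (k ∸ j) (coprime-∸ j≤k j⊥k))) (begin
    χ (k ∸ j) * (χ̄ (k ∸ 1) * χ̄ j)                   ≈⟨ *-congʳ χ[k-j]≈χ[k-1]χj ⟩
    (χ (k ∸ 1) * χ j) * (χ̄ (k ∸ 1) * χ̄ j)           ≈⟨ interchange (χ (k ∸ 1)) (χ j) (χ̄ (k ∸ 1)) (χ̄ j) ⟩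
    (χ (k ∸ 1) * χ̄ (k ∸ 1)) * (χ j * χ̄ j)
      ≈⟨ *-cong (trans (*-comm _ _) χ̄χ[k-1]≈1) (trans (*-comm _ _) (proj₁ χ̄-conj j j⊥k)) ⟩
    1# * 1#                                          ≈⟨ *-identityˡ 1# ⟩
    1#                                               ∎)
    where
    χ[k-j]≈χ[k-1]χj : χ (k ∸ j) ≈ χ (k ∸ 1) * χ j
    χ[k-j]≈χ[k-1]χj = trans (reflexive (P.cong (λ t → χ (t ∸ j)) (P.sym (ℕP.*-identityˡ k))))
                            (χ-reflect 1 j (P.subst (j ℕ.≤_) (P.sym (ℕP.*-identityˡ k)) j≤k))
    inverse-unique : ∀ x {y y′} → x * y ≈ 1# → x * y′ ≈ 1# → y ≈ y′
    inverse-unique x {y} {y′} xy≈1 xy′≈1 = begin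
      y              ≈⟨ *-identityʳ y ⟨
      y * 1#         ≈⟨ *-congˡ xy′≈1 ⟨
      y * (x * y′)   ≈⟨ *-assoc y x y′ ⟨
      (y * x) * y′   ≈⟨ *-congʳ (trans (*-comm y x) xy≈1) ⟩
      1# * y′        ≈⟨ *-identityˡ y′ ⟩
      y′             ∎

  B : ℚ → Carrier
  B = bernChar χ̄ k p

  term : ℚ → ℕ → Carrier
  term x j = χ̄ j * ι (bernFun p ((ℕ→ℚ j ℚ.+ x) ℚ.* ((+ 1) ÷ℕ k)))

  B≈ : ∀ x → B x ≈ ι (ℕ→ℚ (k ℕ.^ (p ∸ 1))) * Σ k (term x)
  B≈ x = *-congˡ (reflexive (∑₀≡Σ k (term x)))

  bernChar-periodic : ∀ x m → B (x ℚ.+ ℤ→ℚ (m ℤ.* + k)) ≈ B x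
  bernChar-periodic x m = trans (B≈ _) (trans (*-congˡ (Σ-cong k term≈)) (sym (B≈ x)))
    where
    term≈ : ∀ j → term (x ℚ.+ ℤ→ℚ (m ℤ.* + k)) j ≈ term x j
    term≈ j = *-congˡ (reflexive (P.cong ι (P.trans (P.cong (bernFun p) (÷-shift (suc k₂) (ℕ→ℚ j) x m))
                                                      (bernFun-+ℤ p _ m))))

  bernChar-reflect : ∀ x m → B (ℤ→ℚ (m ℤ.* + k) ℚ.- x) ≈ - (χ̄ (k ∸ 1) * B x)
  bernChar-reflect x m = begin
    B y                                      ≈⟨ B≈ y ⟩
    K * (term y 0 + Σ₁ (suc k₂) (term y))    ≈⟨ *-congˡ (+-cong (term-0≈0 y) reflected-sum) ⟩
    K * (0# + - (c̄ * T))                     ≈⟨ *-congˡ (+-identityˡ _) ⟩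
    K * - (c̄ * T)                            ≈⟨ -‿distribʳ-* K (c̄ * T) ⟨
    - (K * (c̄ * T))                          ≈⟨ -‿cong (x∙yz≈y∙xz K c̄ T) ⟩
    - (c̄ * (K * T))                          ≈⟨ -‿cong (*-congˡ (*-congˡ (trans (+-congʳ (term-0≈0 x)) (+-identityˡ T)))) ⟨
    - (c̄ * (K * (term x 0 + T)))             ≈⟨ -‿cong (*-congˡ (B≈ x)) ⟨
    - (c̄ * B x)                              ∎
    where
    y : ℚ
    y = ℤ→ℚ (m ℤ.* + k) ℚ.- x
    K c̄ T : Carrier
    K = ι (ℕ→ℚ (k ℕ.^ (p ∸ 1)))
    c̄ = χ̄ (k ∸ 1)
    T = Σ₁ (suc k₂) (term x)
    term-0≈0 : ∀ x → term x 0 ≈ 0#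
    term-0≈0 x = trans (*-congʳ χ̄0≈0) (zeroˡ _)
    term-reflect : ∀ j → j ℕ.≤ k → term y (k ∸ j) ≈ - (c̄ * term x j)
    term-reflect j j≤k = begin
      χ̄ (k ∸ j) * ι (bernFun p ((ℕ→ℚ (k ∸ j) ℚ.+ y) ℚ.* u))
        ≡⟨ P.cong (λ t → χ̄ (k ∸ j) * ι (bernFun p t)) (÷-reflect (suc k₂) j x m j≤k) ⟩
      χ̄ (k ∸ j) * ι (bernFun p (ℚ.- w ℚ.+ ℤ→ℚ (m ℤ.+ + 1)))
        ≡⟨ P.cong (λ t → χ̄ (k ∸ j) * ι t) (P.trans (bernFun-+ℤ p (ℚ.- w) (m ℤ.+ + 1)) (bernFun-neg p w p-odd)) ⟩
      χ̄ (k ∸ j) * ι (ℚ.- bernFun p w)                         ≈⟨ *-cong (χ̄-reflect j j≤k) (-‿homo (bernFun p w)) ⟩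
      (c̄ * χ̄ j) * - ι (bernFun p w)                           ≈⟨ -‿distribʳ-* _ _ ⟨
      - ((c̄ * χ̄ j) * ι (bernFun p w))                         ≈⟨ -‿cong (*-assoc c̄ (χ̄ j) _) ⟩
      - (c̄ * term x j)                                        ∎
      where
      u w : ℚ
      u = (+ 1) ÷ℕ k
      w = (ℕ→ℚ j ℚ.+ x) ℚ.* u
    reflected-sum : Σ₁ (suc k₂) (term y) ≈ - (c̄ * T)
    reflected-sum = begin
      Σ₁ (suc k₂) (term y)                          ≈⟨ Σ₁-reverse (suc k₂) (term y) ⟩
      Σ (suc k₂) (λ i → term y (k ∸ suc i))         ≈⟨ Σ-cong-< (suc k₂) (λ i i<k-1 → term-reflect (suc i) (ℕP.<⇒≤ (s≤s i<k-1))) ⟩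
      Σ (suc k₂) (λ i → - (c̄ * term x (suc i)))    ≈⟨ Σ-neg (suc k₂) (λ i → c̄ * term x (suc i)) ⟩
      - Σ (suc k₂) (λ i → c̄ * term x (suc i))      ≈⟨ -‿cong (Σ-*ˡ (suc k₂) c̄ (term x ∘ suc)) ⟩
      - (c̄ * T)                                     ∎

  χB : (ℕ → ℚ) → ℕ → Carrier
  χB x n = χ n * B (x n)

  module _ (U : ℕ) (x : ℕ → ℚ) (m : ℤ)
    (x-shift : ∀ n → x (n ℕ.+ U ℕ.* k) ≡ x n ℚ.+ ℤ→ℚ (m ℤ.* + k))
    (x-reflect : ∀ n → n ℕ.≤ U ℕ.* k → x (U ℕ.* k ∸ n) ≡ ℤ→ℚ (m ℤ.* + k) ℚ.- x n) where

    χB-periodic : Periodic (U ℕ.* k) (χB x)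
    χB-periodic n = *-cong (χ-+-multiple n U) (trans (reflexive (P.cong B (x-shift n))) (bernChar-periodic (x n) m))

    χB-reflectionOdd : ReflectionOdd (U ℕ.* k) (χB x)
    χB-reflectionOdd n n≤Uk = begin
      χ (U ℕ.* k ∸ n) * B (x (U ℕ.* k ∸ n))     ≈⟨ *-cong (χ-reflect U n n≤Uk) (trans (reflexive (P.cong B (x-reflect n n≤Uk)))
                                                                                     (bernChar-reflect (x n) m)) ⟩
      (c * χ n) * - (c̄ * B (x n))              ≈⟨ -‿distribʳ-* _ _ ⟨
      - ((c * χ n) * (c̄ * B (x n)))            ≈⟨ -‿cong (interchange c (χ n) c̄ (B (x n))) ⟩
      - ((c * c̄) * (χ n * B (x n)))            ≈⟨ -‿cong (*-congʳ (trans (*-comm c c̄) χ̄χ[k-1]≈1)) ⟩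
      - (1# * (χ n * B (x n)))                 ≈⟨ -‿cong (*-identityˡ _) ⟩
      - (χ n * B (x n))                        ∎
      where
      c c̄ : Carrier
      c = χ (k ∸ 1)
      c̄ = χ̄ (k ∸ 1)

  sgn-suc : ∀ n → sgn (suc n) ≈ - sgn n
  sgn-suc zero          = refl
  sgn-suc (suc zero)    = sym (-‿involutive 1#)
  sgn-suc (suc (suc n)) = sgn-suc n

  sgn-double : ∀ t → sgn (t ℕ.+ t) ≈ 1#
  sgn-double zero    = refl
  sgn-double (suc t) = trans (reflexive (P.cong (sgn ∘ suc) (ℕP.+-suc t t))) (sgn-double t)

  sgn-even-sum : ∀ a b t → a ℕ.+ b ≡ t ℕ.+ t → sgn a ≈ sgn b
  sgn-even-sum zero          b t       a+b≡2t = sym (trans (reflexive (P.cong sgn a+b≡2t)) (sgn-double t))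
  sgn-even-sum (suc zero)    b (suc t) a+b≡2t = sym (begin
    sgn b                  ≡⟨ P.cong sgn (P.trans (ℕP.suc-injective a+b≡2t) (ℕP.+-suc t t)) ⟩
    sgn (suc (t ℕ.+ t))    ≈⟨ sgn-suc (t ℕ.+ t) ⟩
    - sgn (t ℕ.+ t)        ≈⟨ -‿cong (sgn-double t) ⟩
    - 1#                   ∎)
  sgn-even-sum (suc (suc a)) b (suc t) a+b≡2t =
    sgn-even-sum a b t (ℕP.suc-injective (P.trans (ℕP.suc-injective a+b≡2t) (ℕP.+-suc t t)))
  sgn-even-sum (suc zero)    b zero    ()
  sgn-even-sum (suc (suc a)) b zero    ()

  sgn-periodic : ∀ N t → N ≡ t ℕ.+ t → Periodic N sgn
  sgn-periodic N t N≡2t n = sgn-even-sum (n ℕ.+ N) n (n ℕ.+ t) (P.trans (P.cong (λ L → (n ℕ.+ L) ℕ.+ n) N≡2t) (rearrange n t))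
    where
    rearrange : ∀ n t → (n ℕ.+ (t ℕ.+ t)) ℕ.+ n ≡ (n ℕ.+ t) ℕ.+ (n ℕ.+ t)
    rearrange = ℕ-solve-∀

  sgn-reflectionEven : ∀ N t → N ≡ t ℕ.+ t → ReflectionEven N sgn
  sgn-reflectionEven N t N≡2t n n≤N = sgn-even-sum (N ∸ n) n t (P.trans (ℕP.m∸n+n≡m n≤N) N≡2t)

  ∑₁-half-periods : ∀ c {h g g′ : ℕ → Carrier} → (∀ n → g n ≈ h n) → (∀ n → g′ n ≈ h n) →
    Periodic ((c ℕ.+ c) ℕ.* k) h → ReflectionOdd ((c ℕ.+ c) ℕ.* k) h → ∀ q →
      (¬ (2 ∣ q) → ∑₁ ((q ℕ.* c) ℕ.* k) g′ ≈ ∑₁ (c ℕ.* k) g) × (2 ∣ q → ∑₁ ((q ℕ.* c) ℕ.* k) g′ ≈ 0#)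
  ∑₁-half-periods c {h} {g} {g′} g≈h g′≈h h-per h-odd q =
    (λ q-odd → trans scaled≈ (trans (proj₁ halves q-odd) (sym unscaled≈))) , (λ q-even → trans scaled≈ (proj₂ halves q-even))
    where
    M : ℕ
    M = c ℕ.* k
    [c+c]k≡M+M : (c ℕ.+ c) ℕ.* k ≡ M ℕ.+ M
    [c+c]k≡M+M = ℕP.*-distribʳ-+ k c c
    halves : (¬ (2 ∣ q) → Σ₁ (q ℕ.* M) h ≈ Σ₁ M h) × (2 ∣ q → Σ₁ (q ℕ.* M) h ≈ 0#)
    halves = Σ₁-half-periods halve M (P.subst (λ N → Periodic N h) [c+c]k≡M+M h-per)
                                     (P.subst (λ N → ReflectionOdd N h) [c+c]k≡M+M h-odd) q
    scaled≈ : ∑₁ ((q ℕ.* c) ℕ.* k) g′ ≈ Σ₁ (q ℕ.* M) h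
    scaled≈ = trans (reflexive (∑₀≡Σ ((q ℕ.* c) ℕ.* k) (g′ ∘ suc)))
                    (trans (Σ-cong ((q ℕ.* c) ℕ.* k) (g′≈h ∘ suc)) (reflexive (P.cong (λ N → Σ₁ N h) (ℕP.*-assoc q c k))))
    unscaled≈ : ∑₁ M g ≈ Σ₁ M h
    unscaled≈ = trans (reflexive (∑₀≡Σ M (g ∘ suc))) (Σ-cong M (g≈h ∘ suc))

  S-scaling : ∀ c′ q′ d → let c = suc c′; q = suc q′ in
      (¬ (2 ∣ q) → S χ χ̄ k p (+ q ℤ.* d) (q ℕ.* c) ≈ S χ χ̄ k p d c)
    × (2 ∣ q → S χ χ̄ k p (+ q ℤ.* d) (q ℕ.* c) ≈ 0#)
  S-scaling c′ q′ d = ∑₁-half-periods c (λ _ → refl) scaled≈ (χB-periodic (c ℕ.+ c) x A x-shift x-reflect)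
                                                         (χB-reflectionOdd (c ℕ.+ c) x A x-shift x-reflect) q
    where
    c q N : ℕ
    c = suc c′
    q = suc q′
    N = (c ℕ.+ c) ℕ.* k
    A : ℤ
    A = d ℤ.+ + (c ℕ.* k)
    x : ℕ → ℚ
    x n = (A ℤ.* + n) ÷ℕ (2 ℕ.* c)
    AN≡[Ak][2c] : A ℤ.* + N ≡ (A ℤ.* + k) ℤ.* + (2 ℕ.* c)
    AN≡[Ak][2c] rewrite ℤP.pos-* (c ℕ.+ c) k | ℤP.pos-+ c c | ℤP.pos-* 2 c = cross A (+ c) (+ k)
      where
      cross : ∀ A c k → A ℤ.* ((c ℤ.+ c) ℤ.* k) ≡ (A ℤ.* k) ℤ.* (+ 2 ℤ.* c)
      cross = ℤ-solve-∀
    x-shift : ∀ n → x (n ℕ.+ N) ≡ x n ℚ.+ ℤ→ℚ (A ℤ.* + k)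
    x-shift = linear-÷ℕ-periodic A _ N (A ℤ.* + k) AN≡[Ak][2c]
    x-reflect : ∀ n → n ℕ.≤ N → x (N ∸ n) ≡ ℤ→ℚ (A ℤ.* + k) ℚ.- x n
    x-reflect = linear-÷ℕ-reflect A _ N (A ℤ.* + k) AN≡[Ak][2c]
    scaled≈ : ∀ n → χ n * B (((+ q ℤ.* d ℤ.+ + ((q ℕ.* c) ℕ.* k)) ℤ.* + n) ÷ℕ (2 ℕ.* (q ℕ.* c))) ≈ χB x n
    scaled≈ n = *-congˡ (reflexive (P.cong B (÷ℕ-cross ((+ q ℤ.* d ℤ.+ + ((q ℕ.* c) ℕ.* k)) ℤ.* + n) (A ℤ.* + n) _ _ eq)))
      where
      cross : ∀ q d c k n →
        ((q ℤ.* d ℤ.+ q ℤ.* c ℤ.* k) ℤ.* n) ℤ.* (+ 2 ℤ.* c) ≡ ((d ℤ.+ c ℤ.* k) ℤ.* n) ℤ.* (+ 2 ℤ.* (q ℤ.* c))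
      cross = ℤ-solve-∀
      eq : ((+ q ℤ.* d ℤ.+ + ((q ℕ.* c) ℕ.* k)) ℤ.* + n) ℤ.* + (2 ℕ.* c) ≡ (A ℤ.* + n) ℤ.* + (2 ℕ.* (q ℕ.* c))
      eq rewrite ℤP.pos-* (q ℕ.* c) k | ℤP.pos-* 2 (q ℕ.* c) | ℤP.pos-* q c | ℤP.pos-* 2 c | ℤP.pos-* c k =
        cross (+ q) d (+ c) (+ k) (+ n)

  s₃-scaling : ∀ c′ q′ d → let c = suc c′; q = suc q′ in
      (¬ (2 ∣ q) → s₃ χ χ̄ k p (+ q ℤ.* d) (q ℕ.* c) ≈ s₃ χ χ̄ k p d c)
    × (2 ∣ q → s₃ χ χ̄ k p (+ q ℤ.* d) (q ℕ.* c) ≈ 0#)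
  s₃-scaling c′ q′ d = ∑₁-half-periods c {h} (λ n → *-assoc (sgn n) (χ n) _) scaled≈
    (*-periodic N (sgn-periodic N (c ℕ.* k) N≡ck+ck) (χB-periodic (c ℕ.+ c) x (+ 2 ℤ.* d) x-shift x-reflect))
    (*-reflectionOdd N (sgn-reflectionEven N (c ℕ.* k) N≡ck+ck) (χB-reflectionOdd (c ℕ.+ c) x (+ 2 ℤ.* d) x-shift x-reflect)) q
    where
    c q N : ℕ
    c = suc c′
    q = suc q′
    N = (c ℕ.+ c) ℕ.* k
    x : ℕ → ℚ
    x n = (d ℤ.* + n) ÷ℕ c
    h : ℕ → Carrier
    h n = sgn n * χB x n
    N≡ck+ck : N ≡ c ℕ.* k ℕ.+ c ℕ.* k
    N≡ck+ck = ℕP.*-distribʳ-+ k c c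
    dN≡[2dk]c : d ℤ.* + N ≡ ((+ 2 ℤ.* d) ℤ.* + k) ℤ.* + c
    dN≡[2dk]c rewrite ℤP.pos-* (c ℕ.+ c) k | ℤP.pos-+ c c = cross d (+ c) (+ k)
      where
      cross : ∀ d c k → d ℤ.* ((c ℤ.+ c) ℤ.* k) ≡ ((+ 2 ℤ.* d) ℤ.* k) ℤ.* c
      cross = ℤ-solve-∀
    x-shift : ∀ n → x (n ℕ.+ N) ≡ x n ℚ.+ ℤ→ℚ ((+ 2 ℤ.* d) ℤ.* + k)
    x-shift = linear-÷ℕ-periodic d c′ N ((+ 2 ℤ.* d) ℤ.* + k) dN≡[2dk]c
    x-reflect : ∀ n → n ℕ.≤ N → x (N ∸ n) ≡ ℤ→ℚ ((+ 2 ℤ.* d) ℤ.* + k) ℚ.- x n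
    x-reflect = linear-÷ℕ-reflect d c′ N ((+ 2 ℤ.* d) ℤ.* + k) dN≡[2dk]c
    scaled≈ : ∀ n → sgn n * χ n * B (((+ q ℤ.* d) ℤ.* + n) ÷ℕ (q ℕ.* c)) ≈ h n
    scaled≈ n = trans (*-assoc (sgn n) (χ n) _)
                      (*-congˡ (*-congˡ (reflexive (P.cong B (÷ℕ-cross ((+ q ℤ.* d) ℤ.* + n) (d ℤ.* + n) _ c′ eq)))))
      where
      cross : ∀ q d c n → ((q ℤ.* d) ℤ.* n) ℤ.* c ≡ (d ℤ.* n) ℤ.* (q ℤ.* c)
      cross = ℤ-solve-∀
      eq : ((+ q ℤ.* d) ℤ.* + n) ℤ.* + c ≡ (d ℤ.* + n) ℤ.* + (q ℕ.* c)
      eq rewrite ℤP.pos-* q c = cross (+ q) d (+ c) (+ n)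

  s₄-scaling : ∀ c′ q′ d → let c = suc c′; q = suc q′ in
      (¬ (2 ∣ q) → s₄ χ χ̄ k p (+ q ℤ.* d) (q ℕ.* c) ≈ s₄ χ χ̄ k p d c)
    × (2 ∣ q → s₄ χ χ̄ k p (+ q ℤ.* d) (q ℕ.* c) ≈ 0#)
  s₄-scaling c′ q′ d = ∑₁-half-periods c (λ _ → refl) scaled≈ (χB-periodic (c ℕ.+ c) x d x-shift x-reflect)
                                                         (χB-reflectionOdd (c ℕ.+ c) x d x-shift x-reflect) q
    where
    c q N : ℕ
    c = suc c′
    q = suc q′
    N = (c ℕ.+ c) ℕ.* k
    x : ℕ → ℚ
    x n = (d ℤ.* + n) ÷ℕ (2 ℕ.* c)
    dN≡[dk][2c] : d ℤ.* + N ≡ (d ℤ.* + k) ℤ.* + (2 ℕ.* c)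
    dN≡[dk][2c] rewrite ℤP.pos-* (c ℕ.+ c) k | ℤP.pos-+ c c | ℤP.pos-* 2 c = cross d (+ c) (+ k)
      where
      cross : ∀ d c k → d ℤ.* ((c ℤ.+ c) ℤ.* k) ≡ (d ℤ.* k) ℤ.* (+ 2 ℤ.* c)
      cross = ℤ-solve-∀
    x-shift : ∀ n → x (n ℕ.+ N) ≡ x n ℚ.+ ℤ→ℚ (d ℤ.* + k)
    x-shift = linear-÷ℕ-periodic d _ N (d ℤ.* + k) dN≡[dk][2c]
    x-reflect : ∀ n → n ℕ.≤ N → x (N ∸ n) ≡ ℤ→ℚ (d ℤ.* + k) ℚ.- x n
    x-reflect = linear-÷ℕ-reflect d _ N (d ℤ.* + k) dN≡[dk][2c]
    scaled≈ : ∀ n → χ n * B (((+ q ℤ.* d) ℤ.* + n) ÷ℕ (2 ℕ.* (q ℕ.* c))) ≈ χB x n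
    scaled≈ n = *-congˡ (reflexive (P.cong B (÷ℕ-cross ((+ q ℤ.* d) ℤ.* + n) (d ℤ.* + n) _ _ eq)))
      where
      cross : ∀ q d c n → ((q ℤ.* d) ℤ.* n) ℤ.* (+ 2 ℤ.* c) ≡ (d ℤ.* n) ℤ.* (+ 2 ℤ.* (q ℤ.* c))
      cross = ℤ-solve-∀
      eq : ((+ q ℤ.* d) ℤ.* + n) ℤ.* + (2 ℕ.* c) ≡ (d ℤ.* + n) ℤ.* + (2 ℕ.* (q ℕ.* c))
      eq rewrite ℤP.pos-* 2 (q ℕ.* c) | ℤP.pos-* q c | ℤP.pos-* 2 c = cross (+ q) d (+ c) (+ n)

mod-1-principal : ∀ {a ℓ : Level} (R : CommutativeRing a ℓ) (ι : ℚ → CommutativeRing.Carrier R)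
  (χ : ℕ → CommutativeRing.Carrier R) →
  Char.IsDirichletCharacter R ι 1 χ → ¬ Char.NonPrincipal R ι 1 χ
mod-1-principal R ι χ χ-char (n , _ , χn≉1) = χn≉1 (χ≈1 n)
  where
  open CommutativeRing R
  open Char.IsDirichletCharacter χ-char
  χ≈1 : ∀ n → χ n ≈ 1#
  χ≈1 zero    = trans (sym (periodic 0)) one
  χ≈1 (suc n) = trans (reflexive (P.cong χ (ℕP.+-comm 1 n))) (trans (periodic n) (χ≈1 n))

open import Data.Nat using (_≤_; _<_) renaming (_*_ to _*ℕ_)
open import Data.Integer using (∣_∣) renaming (_+_ to _+ℤ_; _*_ to _*ℤ_)
open import Data.Integer.Divisibility using () renaming (_∣_ to _∣ℤ_)
open import Data.Sum using (_⊎_)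

proposition1 :
  ∀ {a ℓ : Level} (R : CommutativeRing a ℓ) →
  let open CommutativeRing R
      open Char R
  in
  -- R is an integral domain of characteristic 0 (a ℚ-algebra) -- stands in for ℂ
  (ι : ℚ → Carrier) → IsRingHomomorphism +-*-rawRing rawRing ι →
  ¬ (1# ≈ 0#) → (∀ x y → x * y ≈ 0# → (x ≈ 0#) ⊎ (y ≈ 0#)) →
  -- k odd positive, χ a non-principal primitive character mod k, χ̄ its conjugate
  (k : ℕ) → 1 ≤ k → ¬ (2 ∣ k) →
  (χ χ̄ : ℕ → Carrier) →
  IsDirichletCharacter ι k χ → NonPrincipal ι k χ → Primitive ι k χ →
  IsConjugate ι k χ χ̄ →
  -- p odd positive, c > 0, (c,d) = 1, q > 0
  (p : ℕ) → ¬ (2 ∣ p) →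
  (d : ℤ) (c : ℕ) → 0 < c → Coprime c ∣ d ∣ →
  (q : ℕ) → 0 < q →
    (¬ ((+ 2) ∣ℤ (d +ℤ + c)) →
        (¬ (2 ∣ q) → S ι χ χ̄ k p (+ q *ℤ d) (q *ℕ c) ≈ S ι χ χ̄ k p d c)
      × (2 ∣ q → S ι χ χ̄ k p (+ q *ℤ d) (q *ℕ c) ≈ 0#))
  × (¬ (2 ∣ c) →
        (¬ (2 ∣ q) → s₃ ι χ χ̄ k p (+ q *ℤ d) (q *ℕ c) ≈ s₃ ι χ χ̄ k p d c)
      × (2 ∣ q → s₃ ι χ χ̄ k p (+ q *ℤ d) (q *ℕ c) ≈ 0#))
  × (¬ ((+ 2) ∣ℤ d) →
        (¬ (2 ∣ q) → s₄ ι χ χ̄ k p (+ q *ℤ d) (q *ℕ c) ≈ s₄ ι χ χ̄ k p d c)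
      × (2 ∣ q → s₄ ι χ χ̄ k p (+ q *ℤ d) (q *ℕ c) ≈ 0#))
proposition1 R ι ι-hom _ _ zero () _ χ χ̄ χ-char _ _ χ̄-conj p p-odd d c _ _ q _
proposition1 R ι ι-hom _ _ (suc zero) _ _ χ χ̄ χ-char χ-nonprincipal _ χ̄-conj p p-odd d c _ _ q _ =
  ⊥-elim (mod-1-principal R ι χ χ-char χ-nonprincipal)
proposition1 R ι ι-hom _ _ (suc (suc k₂)) _ _ χ χ̄ χ-char _ _ χ̄-conj p p-odd d zero () _ q _
proposition1 R ι ι-hom _ _ (suc (suc k₂)) _ _ χ χ̄ χ-char _ _ χ̄-conj p p-odd d (suc c′) _ _ zero ()
proposition1 R ι ι-hom _ _ (suc (suc k₂)) _ _ χ χ̄ χ-char _ _ χ̄-conj p p-odd d (suc c′) _ _ (suc q′) _ =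
  (λ _ → S-scaling c′ q′ d) , (λ _ → s₃-scaling c′ q′ d) , (λ _ → s₄-scaling c′ q′ d)
  where
  open DirichletBernoulli R ι ι-hom k₂ χ χ̄ χ-char χ̄-conj p p-odd
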